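{- Let $q$ be an odd prime power and let $A=\begin{bmatrix}1&\zeta\\0&0\end{bmatrix}\in M_2(\mathbb{F}_{q^2})$. Then $|\zeta|^2=-1$ if and only if $\Gamma_{F_A}^\wedge\cup W(A)=\mathbb{F}_{q^2}$ and $\Gamma_{F_A}^\wedge\cap W(A)=\varnothing$.
   Context: Fix a nonsquare $\alpha\in\mathbb{F}_q$ and $\beta\in\mathbb{F}_{q^2}$ with $\beta^2=\alpha$, so every element of $\mathbb{F}_{q^2}$ is uniquely $x+\beta y$, $x,y\in\mathbb{F}_q$. Write $\overline{x}:=x^q$, $|x|^2=x\overline{x}$; $M^*$ is the transpose with $\overline{\cdot}$ applied entrywise; $\langle \mathbf u,\mathbf v\rangle:=\mathbf v^*\mathbf u$. $W(A)=\{\langle A\mathbf v,\mathbf v\rangle:\langle\mathbf v,\mathbf v\rangle=1\}$. $H_1=(A+A^*)/2$, $H_2=(A-A^*)/(2\beta)$, $F_A(x,y,t)=\det(xH_1+yH_2+tI_2)$, and $\Gamma_{F_A}^\wedge$ is the dual curve of the projective conic $F_A=0$ (its points $(a:b:1)$, $a,b\in\mathbb{F}_q$, identified with $a+\beta b$); when $F_A$ is a degenerate conic this dual is computed from the dual polynomial, e.g. for $|\zeta|^2=-1$ it is the line $x=1/2$. -}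

module Defs where

open import Level using (0ℓ)
open import Algebra.Bundles using (CommutativeRing)
open import Data.List using (List; length)
open import Data.List.Relation.Unary.Any using (Any)
open import Data.List.Relation.Unary.AllPairs using (AllPairs)
open import Data.Nat using (ℕ; zero; suc)
open import Data.Product using (_×_; _,_; Σ)
open import Data.Sum using (_⊎_)
open import Data.Empty using (⊥)
open import Relation.Nullary using (¬_)

record FiniteField : Set₁ where
  field
    cring : CommutativeRing 0ℓ 0ℓ
  open CommutativeRing cring public hiding (ring)
  field
    _⁻¹        : Carrier → Carrier
    ⁻¹-inverse : ∀ x → ¬ (x ≈ 0#) → x * (x ⁻¹) ≈ 1#
    0≉1        : ¬ (0# ≈ 1#)
    elements   : List Carrier
    complete   : ∀ x → Any (x ≈_) elements
    distinct   : AllPairs (λ x y → ¬ (x ≈ y)) elements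
  card : ℕ
  card = length elements

NonSquare : (F : FiniteField) → FiniteField.Carrier F → Set
NonSquare F α = ∀ s → ¬ (s * s ≈ α)
  where open FiniteField F

-- F_{q^2} realised as { x + β y : x, y ∈ F_q } with β² = α (α a nonsquare).
module Ext (F : FiniteField) (α : FiniteField.Carrier F) where
  open FiniteField F

  K : Set
  K = Carrier × Carrier

  infixl 6 _+K_ _-K_
  infixl 7 _*K_
  infix 4 _≈K_

  _≈K_ : K → K → Set
  (a , b) ≈K (c , d) = (a ≈ c) × (b ≈ d)

  ι : Carrier → K
  ι a = (a , 0#)

  β : K
  β = (0# , 1#)

  0K 1K : K
  0K = ι 0#
  1K = ι 1#

  _+K_ : K → K → K
  (a , b) +K (c , d) = (a + c , b + d)

  -K_ : K → K
  -K (a , b) = (- a , - b)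

  _-K_ : K → K → K
  x -K y = x +K (-K y)

  _*K_ : K → K → K
  (a , b) *K (c , d) = (a * c + α * (b * d) , a * d + b * c)

  -- inverse in F_q(β): (a + βb)⁻¹ = (a - βb) / (a² - α b²)
  invK : K → K
  invK (a , b) = (a * n , - (b * n))
    where n = (a * a + - (α * (b * b))) ⁻¹

  powK : K → ℕ → K
  powK x zero    = 1K
  powK x (suc n) = x *K powK x n

  conj : K → K
  conj x = powK x card

  normSq : K → K
  normSq x = x *K conj x

  record M2 : Set where
    constructor mat
    field m11 m12 m21 m22 : K
  open M2 public

  _+M_ : M2 → M2 → M2
  A +M B = mat (m11 A +K m11 B) (m12 A +K m12 B) (m21 A +K m21 B) (m22 A +K m22 B)

  _-M_ : M2 → M2 → M2
  A -M B = mat (m11 A -K m11 B) (m12 A -K m12 B) (m21 A -K m21 B) (m22 A -K m22 B)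

  scaleM : K → M2 → M2
  scaleM c A = mat (c *K m11 A) (c *K m12 A) (c *K m21 A) (c *K m22 A)

  star : M2 → M2
  star A = mat (conj (m11 A)) (conj (m21 A)) (conj (m12 A)) (conj (m22 A))

  two : K
  two = 1K +K 1K

  H₁ : M2 → M2
  H₁ A = scaleM (invK two) (A +M star A)

  H₂ : M2 → M2
  H₂ A = scaleM (invK (two *K β)) (A -M star A)

  V2 : Set
  V2 = K × K

  apply : M2 → V2 → V2
  apply A (u₁ , u₂) = ((m11 A *K u₁) +K (m12 A *K u₂) , (m21 A *K u₁) +K (m22 A *K u₂))

  inner : V2 → V2 → K
  inner (u₁ , u₂) (v₁ , v₂) = (conj v₁ *K u₁) +K (conj v₂ *K u₂)

  InW : M2 → K → Set
  InW A z = Σ V2 λ v → (inner v v ≈K 1K) × (inner (apply A v) v ≈K z)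

  -- ternary quadratic forms  cxx x² + cyy y² + ctt t² + cxy xy + cxt xt + cyt yt
  record QF : Set where
    constructor qf
    field cxx cyy ctt cxy cxt cyt : K
  open QF public

  -- F_A(x,y,t) = det(x H₁ + y H₂ + t I₂), expanded as a quadratic form:
  -- (x a₁ + y a₂ + t)(x d₁ + y d₂ + t) - (x b₁ + y b₂)(x c₁ + y c₂)
  detPencil : M2 → M2 → QF
  detPencil P Q =
    qf ((m11 P *K m22 P) -K (m12 P *K m21 P))
       ((m11 Q *K m22 Q) -K (m12 Q *K m21 Q))
       1K
       (((m11 P *K m22 Q) +K (m11 Q *K m22 P)) -K ((m12 P *K m21 Q) +K (m12 Q *K m21 P)))
       (m11 P +K m22 P)
       (m11 Q +K m22 Q)

  FA : M2 → QF
  FA A = detPencil (H₁ A) (H₂ A)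

  -- dual polynomial: u ↦ uᵀ adj(S) u, S the symmetric matrix of the form
  dualEval : QF → K → K → K → K
  dualEval f a b c =
    (A11 *K (a *K a)) +K (A22 *K (b *K b)) +K (A33 *K (c *K c))
    +K (two *K ((A12 *K (a *K b)) +K (A13 *K (a *K c)) +K (A23 *K (b *K c))))
    where
      h = invK two
      s11 = cxx f
      s22 = cyy f
      s33 = ctt f
      s12 = h *K cxy f
      s13 = h *K cxt f
      s23 = h *K cyt f
      A11 = (s22 *K s33) -K (s23 *K s23)
      A22 = (s11 *K s33) -K (s13 *K s13)
      A33 = (s11 *K s22) -K (s12 *K s12)
      A12 = (s13 *K s23) -K (s12 *K s33)
      A13 = (s12 *K s23) -K (s13 *K s22)
      A23 = (s12 *K s13) -K (s11 *K s23)

  -- z ∈ Γ^∧_{F_A}: z = a + β b with (a : b : 1) on the dual curve, a, b ∈ F_q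
  InDual : M2 → K → Set
  InDual A z = Σ (Carrier × Carrier) λ ab →
    (z ≈K (ι (Data.Product.proj₁ ab) +K (β *K ι (Data.Product.proj₂ ab))))
    × (dualEval (FA A) (ι (Data.Product.proj₁ ab)) (ι (Data.Product.proj₂ ab)) 1K ≈K 0K)

  UnionIsAll : M2 → Set
  UnionIsAll A = ∀ z → InDual A z ⊎ InW A z

  Disjoint : M2 → Set
  Disjoint A = ∀ z → InDual A z → InW A z → ⊥

  Aζ : K → M2
  Aζ ζ = mat 1K ζ 0K 0K

-- Write n = |ζ|² ∈ F_q and q = 2k + 1. Conjugation x ↦ x^q sends a + βb to a − βb: a^q = a on F_q,
-- β^q = β α^k = −β by Euler's criterion, and (a + x)^q = a + x^q because (a + X)^q − X^q − a has
-- degree < q and vanishes on F_q. So |x|² is the norm a² − αb², and every element of F_q is a norm.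
-- Up to a nonzero factor, the dual polynomial at (x : y : 1) is the discriminant
-- D(x, y) = (2x + n)² − 4(n + 1)(x² − αy²) of the quadratic (x − m)² − αy² = n m (1 − m) in m = |v₁|²,
-- whose solvability characterises x + βy ∈ W(A). Hence for n ∉ {0, −1} a point with D = 0 lies in both
-- sets and a point with D a nonsquare in neither. If n = −1 then D = (2x − 1)², and the two sets are
-- the line x = 1/2 and its complement. Otherwise a bad point exists: 1 if n = 0; (1 + t)/2 if n + 1 = t²;
-- and else, writing n = a² − αb², the point (1 + βb)/2, where D = (n + 1)a² is zero or a nonsquare.

module Submission where

open import Level using (0ℓ)
open import Algebra.Bundles using (CommutativeMonoid; CommutativeRing)
open import Data.Nat using (_%_)
open import Data.Product using (_×_; _,_)
open import Relation.Binary.PropositionalEquality using (_≡_)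
open import Relation.Nullary using (¬_)
import Algebra.Definitions
open import Defs

module IntegerRingSolver (R : CommutativeRing 0ℓ 0ℓ) where
  open import Data.Nat as ℕ using (ℕ; zero; suc)
  open import Data.Integer as ℤ using (ℤ; +_; -[1+_]; _◃_; sign; ∣_∣)
  import Data.Integer.Properties as ℤ
  open import Data.Sign as Sign using (Sign)
  open import Data.Maybe using (Maybe; just; nothing)
  open import Data.Vec using (Vec)
  open import Data.Vec.Relation.Binary.Pointwise.Inductive as Pointwise using (Pointwise)
  open import Relation.Nullary using (yes; no)
  open import Relation.Binary.PropositionalEquality as ≡ using (_≡_)
  import Algebra.Solver.Ring.AlmostCommutativeRing as ACR
  import Algebra.Solver.Ring as RingSolver

  open CommutativeRing R
  open import Algebra.Properties.Ring ring
  open import Relation.Binary.Reasoning.Setoid setoid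

  fromℕ : ℕ → Carrier
  fromℕ zero          = 0#
  fromℕ (suc zero)    = 1#
  fromℕ (suc (suc n)) = 1# + fromℕ (suc n)

  fromℕ-suc : ∀ n → fromℕ (suc n) ≈ 1# + fromℕ n
  fromℕ-suc zero    = sym (+-identityʳ _)
  fromℕ-suc (suc n) = refl

  fromℕ-homo-+ : ∀ m n → fromℕ (m ℕ.+ n) ≈ fromℕ m + fromℕ n
  fromℕ-homo-+ zero    n = sym (+-identityˡ _)
  fromℕ-homo-+ (suc m) n = begin
    fromℕ (suc (m ℕ.+ n))      ≈⟨ fromℕ-suc (m ℕ.+ n) ⟩
    1# + fromℕ (m ℕ.+ n)       ≈⟨ +-congˡ (fromℕ-homo-+ m n) ⟩
    1# + (fromℕ m + fromℕ n)   ≈⟨ +-assoc _ _ _ ⟨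
    (1# + fromℕ m) + fromℕ n   ≈⟨ +-congʳ (fromℕ-suc m) ⟨
    fromℕ (suc m) + fromℕ n    ∎

  fromℕ-homo-* : ∀ m n → fromℕ (m ℕ.* n) ≈ fromℕ m * fromℕ n
  fromℕ-homo-* zero    n = sym (zeroˡ _)
  fromℕ-homo-* (suc m) n = begin
    fromℕ (n ℕ.+ m ℕ.* n)           ≈⟨ fromℕ-homo-+ n (m ℕ.* n) ⟩
    fromℕ n + fromℕ (m ℕ.* n)       ≈⟨ +-cong (sym (*-identityˡ _)) (fromℕ-homo-* m n) ⟩
    1# * fromℕ n + fromℕ m * fromℕ n ≈⟨ distribʳ _ _ _ ⟨
    (1# + fromℕ m) * fromℕ n        ≈⟨ *-congʳ (fromℕ-suc m) ⟨
    fromℕ (suc m) * fromℕ n         ∎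

  signed : Sign → Carrier → Carrier
  signed Sign.+ x = x
  signed Sign.- x = - x

  signed-cong : ∀ s {x y} → x ≈ y → signed s x ≈ signed s y
  signed-cong Sign.+ e = e
  signed-cong Sign.- e = -‿cong e

  signed-homo-* : ∀ s t x y → signed (s Sign.* t) (x * y) ≈ signed s x * signed t y
  signed-homo-* Sign.+ Sign.+ x y = refl
  signed-homo-* Sign.+ Sign.- x y = -‿distribʳ-* x y
  signed-homo-* Sign.- Sign.+ x y = -‿distribˡ-* x y
  signed-homo-* Sign.- Sign.- x y = begin
    x * y         ≈⟨ -‿involutive (x * y) ⟨
    - - (x * y)   ≈⟨ -‿cong (-‿distribʳ-* x y) ⟩
    - (x * - y)   ≈⟨ -‿distribˡ-* x (- y) ⟩
    - x * - y     ∎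

  fromℤ : ℤ → Carrier
  fromℤ (+ n)    = fromℕ n
  fromℤ -[1+ n ] = - fromℕ (suc n)

  fromℤ-◃ : ∀ s n → fromℤ (s ◃ n) ≈ signed s (fromℕ n)
  fromℤ-◃ Sign.+ zero    = refl
  fromℤ-◃ Sign.- zero    = sym -0#≈0#
  fromℤ-◃ Sign.+ (suc n) = refl
  fromℤ-◃ Sign.- (suc n) = refl

  fromℤ-signed : ∀ i → fromℤ i ≈ signed (sign i) (fromℕ ∣ i ∣)
  fromℤ-signed (+ zero)  = refl
  fromℤ-signed (+ suc n) = refl
  fromℤ-signed -[1+ n ]  = refl

  fromℤ-homo-* : ∀ i j → fromℤ (i ℤ.* j) ≈ fromℤ i * fromℤ j
  fromℤ-homo-* i j = begin
    fromℤ (i ℤ.* j)                                     ≈⟨ fromℤ-◃ (sign i Sign.* sign j) (∣ i ∣ ℕ.* ∣ j ∣) ⟩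
    signed (sign i Sign.* sign j) (fromℕ (∣ i ∣ ℕ.* ∣ j ∣))
      ≈⟨ signed-cong (sign i Sign.* sign j) (fromℕ-homo-* ∣ i ∣ ∣ j ∣) ⟩
    signed (sign i Sign.* sign j) (fromℕ ∣ i ∣ * fromℕ ∣ j ∣) ≈⟨ signed-homo-* (sign i) (sign j) _ _ ⟩
    signed (sign i) (fromℕ ∣ i ∣) * signed (sign j) (fromℕ ∣ j ∣) ≈⟨ *-cong (fromℤ-signed i) (fromℤ-signed j) ⟨
    fromℤ i * fromℤ j                                   ∎

  private
    cancel-1# : ∀ a b → (1# + a) + - (1# + b) ≈ a + - b
    cancel-1# a b = begin
      (1# + a) + - (1# + b)      ≈⟨ +-congˡ (-‿+-comm 1# b) ⟨
      (1# + a) + (- 1# + - b)    ≈⟨ +-assoc _ _ _ ⟩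
      1# + (a + (- 1# + - b))    ≈⟨ +-congˡ (+-assoc _ _ _) ⟨
      1# + ((a + - 1#) + - b)    ≈⟨ +-congˡ (+-congʳ (+-comm _ _)) ⟩
      1# + ((- 1# + a) + - b)    ≈⟨ +-congˡ (+-assoc _ _ _) ⟩
      1# + (- 1# + (a + - b))    ≈⟨ +-assoc _ _ _ ⟨
      (1# + - 1#) + (a + - b)    ≈⟨ +-congʳ (-‿inverseʳ 1#) ⟩
      0# + (a + - b)             ≈⟨ +-identityˡ _ ⟩
      a + - b                    ∎

    shift-1# : ∀ a b → 1# + (1# + (a + b)) ≈ (1# + a) + (1# + b)
    shift-1# a b = begin
      1# + (1# + (a + b)) ≈⟨ +-congˡ (trans (sym (+-assoc _ _ _)) (trans (+-congʳ (+-comm _ _)) (+-assoc _ _ _))) ⟩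
      1# + (a + (1# + b)) ≈⟨ +-assoc _ _ _ ⟨
      (1# + a) + (1# + b) ∎

  fromℤ-⊖ : ∀ m n → fromℤ (m ℤ.⊖ n) ≈ fromℕ m + - fromℕ n
  fromℤ-⊖ zero    zero    = begin
    fromℤ (0 ℤ.⊖ 0) ≡⟨ ≡.cong fromℤ (ℤ.n⊖n≡0 0) ⟩
    0#              ≈⟨ -‿inverseʳ 0# ⟨
    0# + - 0#       ∎
  fromℤ-⊖ (suc m) zero    = sym (trans (+-congˡ -0#≈0#) (+-identityʳ _))
  fromℤ-⊖ zero    (suc n) = sym (+-identityˡ _)
  fromℤ-⊖ (suc m) (suc n) = begin
    fromℤ (suc m ℤ.⊖ suc n)                 ≡⟨ ≡.cong fromℤ (ℤ.[1+m]⊖[1+n]≡m⊖n m n) ⟩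
    fromℤ (m ℤ.⊖ n)                         ≈⟨ fromℤ-⊖ m n ⟩
    fromℕ m + - fromℕ n                     ≈⟨ cancel-1# (fromℕ m) (fromℕ n) ⟨
    (1# + fromℕ m) + - (1# + fromℕ n)       ≈⟨ +-cong (fromℕ-suc m) (-‿cong (fromℕ-suc n)) ⟨
    fromℕ (suc m) + - fromℕ (suc n)         ∎

  fromℤ-homo-+ : ∀ i j → fromℤ (i ℤ.+ j) ≈ fromℤ i + fromℤ j
  fromℤ-homo-+ -[1+ m ] -[1+ n ] = begin
    - fromℕ (suc (suc (m ℕ.+ n)))
      ≈⟨ -‿cong (trans (fromℕ-suc (suc (m ℕ.+ n))) (+-congˡ (trans (fromℕ-suc (m ℕ.+ n)) (+-congˡ (fromℕ-homo-+ m n))))) ⟩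
    - (1# + (1# + (fromℕ m + fromℕ n)))      ≈⟨ -‿cong (shift-1# _ _) ⟩
    - ((1# + fromℕ m) + (1# + fromℕ n))      ≈⟨ -‿+-comm _ _ ⟨
    - (1# + fromℕ m) + - (1# + fromℕ n)      ≈⟨ +-cong (-‿cong (fromℕ-suc m)) (-‿cong (fromℕ-suc n)) ⟨
    - fromℕ (suc m) + - fromℕ (suc n)        ∎
  fromℤ-homo-+ -[1+ m ] (+ n) = trans (fromℤ-⊖ n (suc m)) (+-comm _ _)
  fromℤ-homo-+ (+ m) -[1+ n ] = fromℤ-⊖ m (suc n)
  fromℤ-homo-+ (+ m) (+ n)    = fromℕ-homo-+ m n

  fromℤ-‿homo : ∀ i → fromℤ (ℤ.- i) ≈ - fromℤ i
  fromℤ-‿homo -[1+ n ]  = sym (-‿involutive _)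
  fromℤ-‿homo (+ zero)  = sym -0#≈0#
  fromℤ-‿homo (+ suc n) = refl

  private
    Rᴬ : ACR.AlmostCommutativeRing 0ℓ 0ℓ
    Rᴬ = ACR.fromCommutativeRing R

    fromℤ-homomorphism : CommutativeRing.rawRing ℤ.+-*-commutativeRing ACR.-Raw-AlmostCommutative⟶ Rᴬ
    fromℤ-homomorphism = record
      { ⟦_⟧    = fromℤ
      ; +-homo = fromℤ-homo-+
      ; *-homo = fromℤ-homo-*
      ; -‿homo = fromℤ-‿homo
      ; 0-homo = refl
      ; 1-homo = refl
      }

    fromℤ-≟ : ∀ a b → Maybe (fromℤ a ≈ fromℤ b)
    fromℤ-≟ a b with a ℤ.≟ b
    ... | yes ≡.refl = just refl
    ... | no _       = nothing

  open RingSolver (CommutativeRing.rawRing ℤ.+-*-commutativeRing) Rᴬ fromℤ-homomorphism fromℤ-≟ public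

  open import Algebra.Properties.Semiring.Exp (ACR.AlmostCommutativeRing.semiring Rᴬ) using (^-congˡ)

  ⟦⟧-cong : ∀ {n} (p : Polynomial n) {ρ ρ′ : Vec Carrier n} → Pointwise _≈_ ρ ρ′ → ⟦ p ⟧ ρ ≈ ⟦ p ⟧ ρ′
  ⟦⟧-cong (op [+] p r) e = +-cong (⟦⟧-cong p e) (⟦⟧-cong r e)
  ⟦⟧-cong (op [*] p r) e = *-cong (⟦⟧-cong p e) (⟦⟧-cong r e)
  ⟦⟧-cong (con c)      e = refl
  ⟦⟧-cong (var x)      e = Pointwise.lookup e x
  ⟦⟧-cong (p :^ n)     e = ^-congˡ n (⟦⟧-cong p e)
  ⟦⟧-cong (:- p)       e = -‿cong (⟦⟧-cong p e)

module FoldPermutation (M : CommutativeMonoid 0ℓ 0ℓ) where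
  open import Data.List using (List; []; _∷_; length; foldr)
  open import Data.List.Properties using (length-removeAt′)
  open import Data.List.Relation.Unary.Any using (here; there; _─_; index)
  open import Data.List.Relation.Unary.All as All using (All; []; _∷_)
  open import Data.List.Relation.Unary.AllPairs using (_∷_)
  open import Data.Nat.Properties using (suc-injective)
  open import Data.Empty using (⊥-elim)
  open import Relation.Binary.PropositionalEquality as ≡ using (_≡_)

  open CommutativeMonoid M
  open import Data.List.Membership.Setoid setoid using (_∈_)
  open import Data.List.Relation.Unary.Unique.Setoid setoid using (Unique)
  open import Data.List.Membership.Setoid.Properties using (All[≉]⇒∉; ∈-resp-≈)
  open import Relation.Binary.Reasoning.Setoid setoid

  ∉-distinct : ∀ {x y xs} → All (λ z → ¬ y ≈ z) xs → x ∈ xs → ¬ y ≈ x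
  ∉-distinct y≉xs x∈xs y≈x = All[≉]⇒∉ setoid y≉xs (∈-resp-≈ setoid (sym y≈x) x∈xs)

  fold : List Carrier → Carrier
  fold = foldr _∙_ ε

  fold-─ : ∀ {x} xs (x∈xs : x ∈ xs) → fold xs ≈ x ∙ fold (xs ─ x∈xs)
  fold-─ (y ∷ xs) (here x≈y)   = ∙-congʳ (sym x≈y)
  fold-─ {x} (y ∷ xs) (there x∈xs) = begin
    y ∙ fold xs                   ≈⟨ ∙-congˡ (fold-─ xs x∈xs) ⟩
    y ∙ (x ∙ fold (xs ─ x∈xs))    ≈⟨ assoc _ _ _ ⟨
    (y ∙ x) ∙ fold (xs ─ x∈xs)    ≈⟨ ∙-congʳ (comm _ _) ⟩
    (x ∙ y) ∙ fold (xs ─ x∈xs)    ≈⟨ assoc _ _ _ ⟩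
    x ∙ (y ∙ fold (xs ─ x∈xs))    ∎

  All-─ : ∀ {x} {P : Carrier → Set} xs (x∈xs : x ∈ xs) → All P xs → All P (xs ─ x∈xs)
  All-─ (y ∷ xs) (here _)     (_ ∷ pxs)  = pxs
  All-─ (y ∷ xs) (there x∈xs) (py ∷ pxs) = py ∷ All-─ xs x∈xs pxs

  Unique-─ : ∀ {x} xs (x∈xs : x ∈ xs) → Unique xs → Unique (xs ─ x∈xs)
  Unique-─ (y ∷ xs) (here _)     (_ ∷ u)      = u
  Unique-─ (y ∷ xs) (there x∈xs) (y≉xs ∷ u) = All-─ xs x∈xs y≉xs ∷ Unique-─ xs x∈xs u

  ∈-─ : ∀ {x y} xs (x∈xs : x ∈ xs) → y ∈ xs → ¬ y ≈ x → y ∈ (xs ─ x∈xs)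
  ∈-─ (z ∷ xs) (here x≈z)   (here y≈z)   y≉x = ⊥-elim (y≉x (trans y≈z (sym x≈z)))
  ∈-─ (z ∷ xs) (here _)     (there y∈xs) _   = y∈xs
  ∈-─ (z ∷ xs) (there _)    (here y≈z)   _   = here y≈z
  ∈-─ (z ∷ xs) (there x∈xs) (there y∈xs) y≉x = there (∈-─ xs x∈xs y∈xs y≉x)

  ∉-─ : ∀ {x} xs (x∈xs : x ∈ xs) → Unique xs → All (λ y → ¬ y ≈ x) (xs ─ x∈xs)
  ∉-─ (z ∷ xs) (here x≈z)   (z≉xs ∷ _) = All.map (λ z≉y y≈x → z≉y (sym (trans y≈x x≈z))) z≉xs
  ∉-─ (z ∷ xs) (there x∈xs) (z≉xs ∷ u) = (λ z≈x → ∉-distinct z≉xs x∈xs z≈x) ∷ ∉-─ xs x∈xs u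

  fold-⊆-same-length : ∀ xs ys → Unique xs → Unique ys → (∀ {z} → z ∈ xs → z ∈ ys) →
                       length xs ≡ length ys → fold xs ≈ fold ys
  fold-⊆-same-length []       []  _ _ _ _ = refl
  fold-⊆-same-length (x ∷ xs) ys (x≉xs ∷ uxs) uys xs⊆ys |xs|≡|ys| = begin
    x ∙ fold xs                ≈⟨ ∙-congˡ (fold-⊆-same-length xs (ys ─ x∈ys) uxs (Unique-─ ys x∈ys uys) xs⊆ys─x |xs|≡|ys─x|) ⟩
    x ∙ fold (ys ─ x∈ys)       ≈⟨ fold-─ ys x∈ys ⟨
    fold ys                    ∎
    where
    x∈ys : x ∈ ys
    x∈ys = xs⊆ys (here refl)
    xs⊆ys─x : ∀ {z} → z ∈ xs → z ∈ (ys ─ x∈ys)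
    xs⊆ys─x z∈xs = ∈-─ ys x∈ys (xs⊆ys (there z∈xs)) (λ z≈x → ∉-distinct x≉xs z∈xs (sym z≈x))
    |xs|≡|ys─x| : length xs ≡ length (ys ─ x∈ys)
    |xs|≡|ys─x| = suc-injective (≡.trans |xs|≡|ys| (length-removeAt′ ys (index x∈ys)))

module FiniteFieldFacts (F : FiniteField) where
  open import Data.List using (List; []; _∷_; length; map)
  open import Data.List.Properties using (length-map; length-removeAt′)
  open import Data.List.Relation.Unary.Any using (here; there; index; _─_)
  open import Data.List.Relation.Unary.All using (All; []; _∷_)
  open import Data.List.Relation.Unary.AllPairs using (_∷_)
  open import Data.Nat as ℕ using (ℕ; suc; _≤_; s≤s; z≤n; _/_; _%_)
  import Data.Nat.Properties as ℕ
  open import Data.Nat.DivMod using (m≡m%n+[m/n]*n)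
  open import Data.Integer using (+_)
  open import Data.Product using (_,_)
  open import Data.Sum using (_⊎_; inj₁; inj₂; reduce)
  open import Data.Empty using (⊥-elim)
  open import Relation.Nullary using (¬_; Dec; yes; no)
  open import Relation.Binary.PropositionalEquality as ≡ using (_≡_)

  open FiniteField F
  open import Algebra.Properties.CommutativeSemiring.Exp commutativeSemiring public
    using (_^_; ^-homo-*; ^-distrib-*)
  open import Data.List.Membership.Setoid setoid using (_∈_)
  open import Data.List.Membership.Setoid.Properties using (∈-map⁻)
  open import Data.List.Relation.Unary.Unique.Setoid setoid using (Unique)
  open import Data.List.Relation.Unary.Unique.Setoid.Properties using () renaming (map⁺ to Unique-map⁺)
  open import Relation.Binary.Reasoning.Setoid setoid
  open FoldPermutation +-commutativeMonoid using (∉-distinct)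
  open IntegerRingSolver cring using (solve; _:=_; _:+_; _:*_; _:-_; con; fromℕ; fromℕ-suc; fromℕ-homo-+)

  q : ℕ
  q = card

  infix 4 _≟_
  _≟_ : (x y : Carrier) → Dec (x ≈ y)
  x ≟ y = go elements (complete x) (complete y) distinct
    where
    go : ∀ xs → x ∈ xs → y ∈ xs → Unique xs → Dec (x ≈ y)
    go (z ∷ xs) (here x≈z)   (here y≈z)   _            = yes (trans x≈z (sym y≈z))
    go (z ∷ xs) (here x≈z)   (there y∈xs) (z≉xs ∷ _)   = no (λ x≈y → ∉-distinct z≉xs y∈xs (trans (sym x≈z) x≈y))
    go (z ∷ xs) (there x∈xs) (here y≈z)   (z≉xs ∷ _)   = no (λ x≈y → ∉-distinct z≉xs x∈xs (trans (sym y≈z) (sym x≈y)))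
    go (z ∷ xs) (there x∈xs) (there y∈xs) (_ ∷ u)      = go xs x∈xs y∈xs u

  1≉0 : ¬ 1# ≈ 0#
  1≉0 1≈0 = 0≉1 (sym 1≈0)

  *-cancelˡ : ∀ {a x y} → ¬ a ≈ 0# → a * x ≈ a * y → x ≈ y
  *-cancelˡ {a} {x} {y} a≉0 ax≈ay = begin
    x                   ≈⟨ *-identityˡ x ⟨
    1# * x              ≈⟨ *-congʳ (trans (*-comm _ _) (⁻¹-inverse a a≉0)) ⟨
    (a ⁻¹ * a) * x      ≈⟨ *-assoc _ _ _ ⟩
    a ⁻¹ * (a * x)      ≈⟨ *-congˡ ax≈ay ⟩
    a ⁻¹ * (a * y)      ≈⟨ *-assoc _ _ _ ⟨
    (a ⁻¹ * a) * y      ≈⟨ *-congʳ (trans (*-comm _ _) (⁻¹-inverse a a≉0)) ⟩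
    1# * y              ≈⟨ *-identityˡ y ⟩
    y                   ∎

  x*y≉0 : ∀ {x y} → ¬ x ≈ 0# → ¬ y ≈ 0# → ¬ x * y ≈ 0#
  x*y≉0 {x} x≉0 y≉0 xy≈0 = y≉0 (*-cancelˡ x≉0 (trans xy≈0 (sym (zeroʳ x))))

  x*y≈0⇒x≈0⊎y≈0 : ∀ {x y} → x * y ≈ 0# → x ≈ 0# ⊎ y ≈ 0#
  x*y≈0⇒x≈0⊎y≈0 {x} {y} xy≈0 with x ≟ 0# | y ≟ 0#
  ... | yes x≈0 | _       = inj₁ x≈0
  ... | no _    | yes y≈0 = inj₂ y≈0
  ... | no x≉0  | no y≉0  = ⊥-elim (x*y≉0 x≉0 y≉0 xy≈0)

  x*x≈0⇒x≈0 : ∀ {x} → x * x ≈ 0# → x ≈ 0#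
  x*x≈0⇒x≈0 xx≈0 = reduce (x*y≈0⇒x≈0⊎y≈0 xx≈0)

  module _ where
    open FoldPermutation *-commutativeMonoid using (fold; fold-⊆-same-length; Unique-─; ∉-─; ∈-─)

    units : List Carrier
    units = elements ─ complete 0#

    q≡1+|units| : q ≡ suc (length units)
    q≡1+|units| = length-removeAt′ elements (index (complete 0#))

    private
      fold-units≉0 : ∀ xs → All (λ y → ¬ y ≈ 0#) xs → ¬ fold xs ≈ 0#
      fold-units≉0 []       []          = 1≉0
      fold-units≉0 (x ∷ xs) (x≉0 ∷ xs≉0) = x*y≉0 x≉0 (fold-units≉0 xs xs≉0)

      fold-map-a* : ∀ a xs → fold (map (a *_) xs) ≈ a ^ length xs * fold xs
      fold-map-a* a []       = sym (*-identityˡ _)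
      fold-map-a* a (x ∷ xs) = trans (*-congˡ (fold-map-a* a xs))
        (solve 4 (λ a x p f → (a :* x) :* (p :* f) := (a :* p) :* (x :* f)) refl a x (a ^ length xs) (fold xs))

      ∈-units : ∀ {y} → ¬ y ≈ 0# → y ∈ units
      ∈-units y≉0 = ∈-─ elements (complete 0#) (complete _) y≉0

      units≉0 : All (λ y → ¬ y ≈ 0#) units
      units≉0 = ∉-─ elements (complete 0#) distinct

      ∈units⇒≉0 : ∀ {y} xs → All (λ z → ¬ z ≈ 0#) xs → y ∈ xs → ¬ y ≈ 0#
      ∈units⇒≉0 (x ∷ _)  (x≉0 ∷ _)   (here y≈x)   y≈0 = x≉0 (trans (sym y≈x) y≈0)
      ∈units⇒≉0 (_ ∷ xs) (_ ∷ xs≉0) (there y∈xs) = ∈units⇒≉0 xs xs≉0 y∈xs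

    -- Multiplication by a unit permutes the units, so it fixes their product.
    a^|units|≈1 : ∀ a → ¬ a ≈ 0# → a ^ length units ≈ 1#
    a^|units|≈1 a a≉0 = *-cancelˡ (fold-units≉0 units units≉0) (begin
      P * a ^ length units              ≈⟨ *-comm _ _ ⟩
      a ^ length units * P              ≈⟨ fold-map-a* a units ⟨
      fold (map (a *_) units)           ≈⟨ fold-⊆-same-length (map (a *_) units) units
                                             (Unique-map⁺ setoid setoid (*-cancelˡ a≉0) (Unique-─ elements (complete 0#) distinct))
                                             (Unique-─ elements (complete 0#) distinct) a*units⊆units (length-map (a *_) units) ⟩
      P                                 ≈⟨ *-identityʳ P ⟨
      P * 1#                            ∎)
      where
      P : Carrier
      P = fold units
      a*units⊆units : ∀ {y} → y ∈ map (a *_) units → y ∈ units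
      a*units⊆units y∈ with ∈-map⁻ setoid setoid y∈
      ... | x , x∈units , y≈ax = ∈-units (λ y≈0 → x*y≉0 a≉0 (∈units⇒≉0 units units≉0 x∈units) (trans (sym y≈ax) y≈0))

  fermat : ∀ a → a ^ q ≈ a
  fermat a rewrite q≡1+|units| with a ≟ 0#
  ... | yes a≈0 = trans (*-congʳ a≈0) (trans (zeroˡ _) (sym a≈0))
  ... | no a≉0  = trans (*-congˡ (a^|units|≈1 a a≉0)) (*-identityʳ a)

  module _ where
    open FoldPermutation +-commutativeMonoid using (fold; fold-⊆-same-length)

    private
      fold-map-1+ : ∀ xs → fold (map (_+_ 1#) xs) ≈ fromℕ (length xs) + fold xs
      fold-map-1+ []       = sym (+-identityʳ _)
      fold-map-1+ (x ∷ xs) = begin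
        (1# + x) + fold (map (_+_ 1#) xs)         ≈⟨ +-congˡ (fold-map-1+ xs) ⟩
        (1# + x) + (fromℕ (length xs) + fold xs) ≈⟨ solve 4 (λ o x n f → (o :+ x) :+ (n :+ f) := (o :+ n) :+ (x :+ f)) refl 1# x _ _ ⟩
        (1# + fromℕ (length xs)) + (x + fold xs) ≈⟨ +-congʳ (fromℕ-suc (length xs)) ⟨
        fromℕ (suc (length xs)) + (x + fold xs)  ∎

      1+-injective : ∀ {a b} → 1# + a ≈ 1# + b → a ≈ b
      1+-injective {a} {b} 1+a≈1+b = begin
        a                 ≈⟨ solve 1 (λ a → a := (con (+ 1) :+ a) :- con (+ 1)) refl a ⟩
        (1# + a) - 1#     ≈⟨ +-congʳ 1+a≈1+b ⟩
        (1# + b) - 1#     ≈⟨ solve 1 (λ b → (con (+ 1) :+ b) :- con (+ 1) := b) refl b ⟩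
        b                 ∎
        where open import Data.Integer using (+_)

    -- Translation by 1 permutes the field, so it fixes the sum of all elements.
    q×1≈0 : fromℕ q ≈ 0#
    q×1≈0 = begin
      fromℕ q                               ≈⟨ solve 2 (λ n s → n := (n :+ s) :- s) refl (fromℕ q) S ⟩
      (fromℕ q + S) - S                     ≈⟨ +-congʳ (fold-map-1+ elements) ⟨
      fold (map (_+_ 1#) elements) - S       ≈⟨ +-congʳ (fold-⊆-same-length (map (_+_ 1#) elements) elements
                                                 (Unique-map⁺ setoid setoid 1+-injective distinct) distinct
                                                 (λ {y} _ → complete y) (length-map (_+_ 1#) elements)) ⟩
      S - S                                 ≈⟨ -‿inverseʳ S ⟩
      0#                                    ∎
      where
      S : Carrier
      S = fold elements

  2≤q : 2 ≤ q
  2≤q = go elements (complete 0#) (complete 1#)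
    where
    go : ∀ xs → 0# ∈ xs → 1# ∈ xs → 2 ≤ length xs
    go (_ ∷ _ ∷ _) _            _            = s≤s (s≤s z≤n)
    go (x ∷ [])    (here 0≈x)   (here 1≈x)   = ⊥-elim (0≉1 (trans 0≈x (sym 1≈x)))

  k : ℕ
  k = q / 2

  module _ (q-odd : q % 2 ≡ 1) where

    q≡1+k+k : q ≡ suc (k ℕ.+ k)
    q≡1+k+k = ≡.trans (m≡m%n+[m/n]*n q 2) (≡.trans (≡.cong (ℕ._+ k ℕ.* 2) q-odd)
                (≡.cong suc (≡.trans (ℕ.*-comm k 2) (≡.cong (k ℕ.+_) (ℕ.+-identityʳ k)))))

    2≉0 : ¬ 1# + 1# ≈ 0#
    2≉0 2≈0 = 1≉0 (begin
      1#                                            ≈⟨ solve 1 (λ n → con (+ 1) := (con (+ 1) :+ (n :+ n)) :- n :* (con (+ 1) :+ con (+ 1))) refl (fromℕ k) ⟩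
      (1# + (fromℕ k + fromℕ k)) - fromℕ k * (1# + 1#) ≈⟨ +-cong (sym (trans (fromℕ-suc (k ℕ.+ k)) (+-congˡ (fromℕ-homo-+ k k)))) (-‿cong (*-congˡ 2≈0)) ⟩
      fromℕ (suc (k ℕ.+ k)) - fromℕ k * 0#          ≡⟨ ≡.cong (λ n → fromℕ n - fromℕ k * 0#) q≡1+k+k ⟨
      fromℕ q - fromℕ k * 0#                        ≈⟨ +-cong q×1≈0 (-‿cong (zeroʳ (fromℕ k))) ⟩
      0# - 0#                                       ≈⟨ -‿inverseʳ 0# ⟩
      0#                                            ∎)

    a^k*a^k≈1 : ∀ a → ¬ a ≈ 0# → a ^ k * a ^ k ≈ 1#
    a^k*a^k≈1 a a≉0 = *-cancelˡ a≉0 (begin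
      a * (a ^ k * a ^ k)     ≈⟨ *-congˡ (^-homo-* a k k) ⟨
      a * a ^ (k ℕ.+ k)       ≡⟨ ≡.cong (a ^_) q≡1+k+k ⟨
      a ^ q                   ≈⟨ fermat a ⟩
      a                       ≈⟨ *-identityʳ a ⟨
      a * 1#                  ∎)

module QuadraticExtension (F : FiniteField) (α : FiniteField.Carrier F) (α-nonsquare : NonSquare F α) where
  open import Data.Nat as ℕ using (ℕ; zero; suc)
  open import Data.Product using (_,_; proj₁)
  import Data.Integer
  open Data.Integer using (+_)
  open import Data.Vec as Vec using (Vec)
  open import Data.Vec.Properties using (lookup-map)
  open import Relation.Binary.PropositionalEquality as ≡ using (_≡_)
  open import Data.Empty using (⊥-elim)
  open import Relation.Nullary using (¬_; yes; no)

  open FiniteField F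
  open FiniteFieldFacts F
  open Ext F α
  open IntegerRingSolver cring using (solve; _:=_; _:+_; _:*_; :-_; _:-_; con)
  open import Algebra.Definitions _≈K_ using (AlmostLeftCancellative)
  open import Relation.Binary.Reasoning.Setoid setoid

  ≈K-refl : ∀ {x} → x ≈K x
  ≈K-refl = refl , refl

  ≈K-sym : ∀ {x y} → x ≈K y → y ≈K x
  ≈K-sym (a , b) = sym a , sym b

  ≈K-trans : ∀ {x y z} → x ≈K y → y ≈K z → x ≈K z
  ≈K-trans (a , b) (c , d) = trans a c , trans b d

  +K-cong : ∀ {x y u v} → x ≈K y → u ≈K v → x +K u ≈K y +K v
  +K-cong (a , b) (c , d) = +-cong a c , +-cong b d

  *K-cong : ∀ {x y u v} → x ≈K y → u ≈K v → x *K u ≈K y *K v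
  *K-cong (a , b) (c , d) = +-cong (*-cong a c) (*-congˡ (*-cong b d)) , +-cong (*-cong a d) (*-cong b c)

  -K-cong : ∀ {x y} → x ≈K y → -K x ≈K -K y
  -K-cong (a , b) = -‿cong a , -‿cong b

  *K-assoc : ∀ x y z → (x *K y) *K z ≈K x *K (y *K z)
  *K-assoc (a , b) (c , d) (e , f) =
      solve 7 (λ a b c d e f g → (a :* c :+ g :* (b :* d)) :* e :+ g :* ((a :* d :+ b :* c) :* f)
              := a :* (c :* e :+ g :* (d :* f)) :+ g :* (b :* (c :* f :+ d :* e))) refl a b c d e f α
    , solve 7 (λ a b c d e f g → (a :* c :+ g :* (b :* d)) :* f :+ (a :* d :+ b :* c) :* e
              := a :* (c :* f :+ d :* e) :+ b :* (c :* e :+ g :* (d :* f))) refl a b c d e f α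

  *K-comm : ∀ x y → x *K y ≈K y *K x
  *K-comm (a , b) (c , d) =
      solve 5 (λ a b c d g → a :* c :+ g :* (b :* d) := c :* a :+ g :* (d :* b)) refl a b c d α
    , solve 4 (λ a b c d → a :* d :+ b :* c := c :* b :+ d :* a) refl a b c d

  *K-identityˡ : ∀ x → 1K *K x ≈K x
  *K-identityˡ (a , b) =
      solve 3 (λ a b g → con (+ 1) :* a :+ g :* (con (+ 0) :* b) := a) refl a b α
    , solve 2 (λ a b → con (+ 1) :* b :+ con (+ 0) :* a := b) refl a b

  *K-identityʳ : ∀ x → x *K 1K ≈K x
  *K-identityʳ x = ≈K-trans (*K-comm x 1K) (*K-identityˡ x)

  *K-distribˡ : ∀ x y z → x *K (y +K z) ≈K x *K y +K x *K z
  *K-distribˡ (a , b) (c , d) (e , f) =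
      solve 7 (λ a b c d e f g → a :* (c :+ e) :+ g :* (b :* (d :+ f))
              := (a :* c :+ g :* (b :* d)) :+ (a :* e :+ g :* (b :* f))) refl a b c d e f α
    , solve 6 (λ a b c d e f → a :* (d :+ f) :+ b :* (c :+ e) := (a :* d :+ b :* c) :+ (a :* f :+ b :* e)) refl a b c d e f

  *K-distribʳ : ∀ x y z → (y +K z) *K x ≈K y *K x +K z *K x
  *K-distribʳ x y z = ≈K-trans (*K-comm (y +K z) x)
    (≈K-trans (*K-distribˡ x y z) (+K-cong (*K-comm x y) (*K-comm x z)))

  K-commutativeRing : CommutativeRing 0ℓ 0ℓ
  K-commutativeRing = record
    { Carrier = K ; _≈_ = _≈K_ ; _+_ = _+K_ ; _*_ = _*K_ ; -_ = -K_ ; 0# = 0K ; 1# = 1K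
    ; isCommutativeRing = record
      { isRing = record
        { +-isAbelianGroup = record
          { isGroup = record
            { isMonoid = record
              { isSemigroup = record
                { isMagma = record
                  { isEquivalence = record { refl = ≈K-refl ; sym = ≈K-sym ; trans = ≈K-trans }
                  ; ∙-cong = +K-cong }
                ; assoc = λ { (a , b) (c , d) (e , f) → +-assoc a c e , +-assoc b d f } }
              ; identity = (λ { (a , b) → +-identityˡ a , +-identityˡ b })
                         , (λ { (a , b) → +-identityʳ a , +-identityʳ b }) }
            ; inverse = (λ { (a , b) → -‿inverseˡ a , -‿inverseˡ b })
                      , (λ { (a , b) → -‿inverseʳ a , -‿inverseʳ b })
            ; ⁻¹-cong = -K-cong }
          ; comm = λ { (a , b) (c , d) → +-comm a c , +-comm b d } }
        ; *-cong = *K-cong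
        ; *-assoc = *K-assoc
        ; *-identity = *K-identityˡ , *K-identityʳ
        ; distrib = *K-distribˡ , *K-distribʳ
        }
      ; *-comm = *K-comm
      }
    }

  module KR = CommutativeRing K-commutativeRing
  module KS = IntegerRingSolver K-commutativeRing

  ι-homo-* : ∀ a b → ι (a * b) ≈K ι a *K ι b
  ι-homo-* a b = solve 3 (λ a b g → a :* b := a :* b :+ g :* (con (+ 0) :* con (+ 0))) refl a b α
               , solve 2 (λ a b → con (+ 0) := a :* con (+ 0) :+ con (+ 0) :* b) refl a b

  ι-homo-+ : ∀ a b → ι (a + b) ≈K ι a +K ι b
  ι-homo-+ a b = refl , sym (+-identityˡ 0#)

  ι-‿homo : ∀ a → ι (- a) ≈K -K ι a
  ι-‿homo a = refl , solve 0 (con (+ 0) := :- con (+ 0)) refl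

  ι-cong : ∀ {a b} → a ≈ b → ι a ≈K ι b
  ι-cong a≈b = a≈b , refl

  ι-injective : ∀ {a b} → ι a ≈K ι b → a ≈ b
  ι-injective = proj₁

  β*β≈ι-α : β *K β ≈K ι α
  β*β≈ι-α = solve 1 (λ g → con (+ 0) :* con (+ 0) :+ g :* (con (+ 1) :* con (+ 1)) := g) refl α
          , solve 0 (con (+ 0) :* con (+ 1) :+ con (+ 1) :* con (+ 0) := con (+ 0)) refl

  ≈ι+β*ι : ∀ a b → (a , b) ≈K ι a +K β *K ι b
  ≈ι+β*ι a b = solve 3 (λ a b g → a := a :+ (con (+ 0) :* b :+ g :* (con (+ 1) :* con (+ 0)))) refl a b α
             , solve 1 (λ b → b := con (+ 0) :+ (con (+ 0) :* con (+ 0) :+ con (+ 1) :* b)) refl b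

  σ : K → K
  σ (a , b) = (a , - b)

  σ-ι : ∀ a → σ (ι a) ≈K ι a
  σ-ι a = refl , solve 0 (:- con (+ 0) := con (+ 0)) refl

  norm : K → Carrier
  norm (a , b) = a * a - α * (b * b)

  x*σx≈ι-norm : ∀ x → x *K σ x ≈K ι (norm x)
  x*σx≈ι-norm (a , b) = solve 3 (λ a b g → a :* a :+ g :* (b :* :- b) := a :* a :- g :* (b :* b)) refl a b α
                      , solve 2 (λ a b → a :* :- b :+ b :* a := con (+ 0)) refl a b

  norm-cong : ∀ {x y} → x ≈K y → norm x ≈ norm y
  norm-cong (a , b) = +-cong (*-cong a a) (-‿cong (*-congˡ (*-cong b b)))

  norm-homo-* : ∀ x y → norm (x *K y) ≈ norm x * norm y
  norm-homo-* (a , b) (c , d) = solve 5 (λ a b c d g →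
      (a :* c :+ g :* (b :* d)) :* (a :* c :+ g :* (b :* d)) :- g :* ((a :* d :+ b :* c) :* (a :* d :+ b :* c))
      := (a :* a :- g :* (b :* b)) :* (c :* c :- g :* (d :* d))) refl a b c d α

  norm-σ : ∀ x → norm (σ x) ≈ norm x
  norm-σ (a , b) = solve 3 (λ a b g → a :* a :- g :* (:- b :* :- b) := a :* a :- g :* (b :* b)) refl a b α

  norm-0K : norm 0K ≈ 0#
  norm-0K = solve 1 (λ g → con (+ 0) :* con (+ 0) :- g :* (con (+ 0) :* con (+ 0)) := con (+ 0)) refl α

  norm≈0⇒a*a≈α*b*b : ∀ a b → norm (a , b) ≈ 0# → a * a ≈ α * (b * b)
  norm≈0⇒a*a≈α*b*b a b N≈0 = trans (solve 3 (λ a b g → a :* a := (a :* a :- g :* (b :* b)) :+ g :* (b :* b)) refl a b α)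
                                   (trans (+-congʳ N≈0) (+-identityˡ _))

  -- a² = α b² with b ≠ 0 would make α = (a/b)² a square.
  norm≈0⇒≈0 : ∀ x → norm x ≈ 0# → x ≈K 0K
  norm≈0⇒≈0 (a , b) N≈0 with b ≟ 0#
  ... | yes b≈0 = x*x≈0⇒x≈0 (begin
          a * a                  ≈⟨ norm≈0⇒a*a≈α*b*b a b N≈0 ⟩
          α * (b * b)            ≈⟨ *-congˡ (*-cong b≈0 b≈0) ⟩
          α * (0# * 0#)          ≈⟨ solve 1 (λ g → g :* (con (+ 0) :* con (+ 0)) := con (+ 0)) refl α ⟩
          0#                     ∎) , b≈0
  ... | no b≉0 = ⊥-elim (α-nonsquare (a * b ⁻¹) (begin
          (a * b ⁻¹) * (a * b ⁻¹)        ≈⟨ solve 2 (λ a c → (a :* c) :* (a :* c) := (a :* a) :* (c :* c)) refl a (b ⁻¹) ⟩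
          (a * a) * (b ⁻¹ * b ⁻¹)        ≈⟨ *-congʳ (norm≈0⇒a*a≈α*b*b a b N≈0) ⟩
          (α * (b * b)) * (b ⁻¹ * b ⁻¹)  ≈⟨ solve 3 (λ g b c → (g :* (b :* b)) :* (c :* c) := g :* ((b :* c) :* (b :* c))) refl α b (b ⁻¹) ⟩
          α * ((b * b ⁻¹) * (b * b ⁻¹))  ≈⟨ *-congˡ (*-cong (⁻¹-inverse b b≉0) (⁻¹-inverse b b≉0)) ⟩
          α * (1# * 1#)                  ≈⟨ solve 1 (λ g → g :* (con (+ 1) :* con (+ 1)) := g) refl α ⟩
          α                              ∎))

  invK-inverseʳ : ∀ x → ¬ x ≈K 0K → x *K invK x ≈K 1K
  invK-inverseʳ (a , b) x≉0 =
      (begin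
        a * (a * n) + α * (b * - (b * n))
          ≈⟨ solve 4 (λ a b n g → a :* (a :* n) :+ g :* (b :* :- (b :* n)) := (a :* a :+ :- (g :* (b :* b))) :* n) refl a b n α ⟩
        d * n     ≈⟨ ⁻¹-inverse d (λ d≈0 → x≉0 (norm≈0⇒≈0 (a , b) d≈0)) ⟩
        1#        ∎)
    , solve 3 (λ a b n → a :* :- (b :* n) :+ b :* (a :* n) := con (+ 0)) refl a b n
    where
    d n : Carrier
    d = a * a + - (α * (b * b))
    n = d ⁻¹

  *K-cancelˡ-nonZero : AlmostLeftCancellative 0K _*K_
  *K-cancelˡ-nonZero a x y a≉0 ax≈ay = ≈K-trans (≈K-sym (a⁻¹*a*z≈z x)) (≈K-trans (*K-cong ≈K-refl ax≈ay) (a⁻¹*a*z≈z y))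
    where
    a⁻¹*a*z≈z : ∀ z → invK a *K (a *K z) ≈K z
    a⁻¹*a*z≈z z = ≈K-trans (≈K-sym (KR.*-assoc (invK a) a z))
      (≈K-trans (*K-cong (≈K-trans (KR.*-comm (invK a) a) (invK-inverseʳ a a≉0)) ≈K-refl) (KR.*-identityˡ z))

  x*Ky≉0 : ∀ {x y} → ¬ x ≈K 0K → ¬ y ≈K 0K → ¬ x *K y ≈K 0K
  x*Ky≉0 {x} x≉0 y≉0 xy≈0 = y≉0 (*K-cancelˡ-nonZero x _ _ x≉0 (≈K-trans xy≈0 (≈K-sym (KR.zeroʳ x))))

  powK-cong : ∀ {x y} n → x ≈K y → powK x n ≈K powK y n
  powK-cong zero    x≈y = ≈K-refl
  powK-cong (suc n) x≈y = *K-cong x≈y (powK-cong n x≈y)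

  powK-ι : ∀ a n → powK (ι a) n ≈K ι (a ^ n)
  powK-ι a zero    = ≈K-refl
  powK-ι a (suc n) = ≈K-trans (*K-cong ≈K-refl (powK-ι a n)) (≈K-sym (ι-homo-* a (a ^ n)))

  module FS = IntegerRingSolver cring

  toF : ∀ {m} → KS.Polynomial m → FS.Polynomial m
  toF (KS.op KS.[+] p r) = FS.op FS.[+] (toF p) (toF r)
  toF (KS.op KS.[*] p r) = FS.op FS.[*] (toF p) (toF r)
  toF (KS.con c)         = FS.con c
  toF (KS.var x)         = FS.var x
  toF (p KS.:^ m)        = toF p FS.:^ m
  toF (KS.:- p)          = FS.:- toF p

  ι-fromℕ : ∀ m → ι (FS.fromℕ m) ≈K KS.fromℕ m
  ι-fromℕ zero          = ≈K-refl
  ι-fromℕ (suc zero)    = ≈K-refl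
  ι-fromℕ (suc (suc m)) = ≈K-trans (ι-homo-+ 1# (FS.fromℕ (suc m))) (+K-cong ≈K-refl (ι-fromℕ (suc m)))

  ι-fromℤ : ∀ c → ι (FS.fromℤ c) ≈K KS.fromℤ c
  ι-fromℤ (+ m)                   = ι-fromℕ m
  ι-fromℤ (Data.Integer.-[1+ m ]) = ≈K-trans (ι-‿homo _) (-K-cong (ι-fromℕ (suc m)))

  ι-⟦⟧ : ∀ {m} (p : KS.Polynomial m) (ρ : Vec Carrier m) → KS.⟦ p ⟧ (Vec.map ι ρ) ≈K ι (FS.⟦ toF p ⟧ ρ)
  ι-⟦⟧ (KS.op KS.[+] p r) ρ = ≈K-trans (+K-cong (ι-⟦⟧ p ρ) (ι-⟦⟧ r ρ)) (≈K-sym (ι-homo-+ _ _))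
  ι-⟦⟧ (KS.op KS.[*] p r) ρ = ≈K-trans (*K-cong (ι-⟦⟧ p ρ) (ι-⟦⟧ r ρ)) (≈K-sym (ι-homo-* _ _))
  ι-⟦⟧ (KS.con c)         ρ = ≈K-sym (ι-fromℤ c)
  ι-⟦⟧ (KS.var x)         ρ = ≡.subst (λ t → t ≈K ι (Vec.lookup ρ x)) (≡.sym (lookup-map x ι ρ)) ≈K-refl
  ι-⟦⟧ (p KS.:^ m)        ρ = ι-^ m
    where
    ι-^ : ∀ m → KS.⟦ p KS.:^ m ⟧ (Vec.map ι ρ) ≈K ι (FS.⟦ toF p FS.:^ m ⟧ ρ)
    ι-^ zero    = ≈K-refl
    ι-^ (suc m) = ≈K-trans (*K-cong (ι-⟦⟧ p ρ) (ι-^ m)) (≈K-sym (ι-homo-* _ _))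
  ι-⟦⟧ (KS.:- p)          ρ = ≈K-trans (-K-cong (ι-⟦⟧ p ρ)) (≈K-sym (ι-‿homo _))

module PolynomialRoots (R : CommutativeRing 0ℓ 0ℓ)
  (*-cancelˡ-nonZero : Algebra.Definitions.AlmostLeftCancellative (CommutativeRing._≈_ R) (CommutativeRing.0# R) (CommutativeRing._*_ R))
  where
  open import Data.Nat using (zero; suc; _≤_; s≤s)
  open import Data.Product using (Σ-syntax; _,_)
  open import Data.Vec using (Vec; []; _∷_; _∷ʳ_; replicate; zipWith)
  open import Data.Vec.Relation.Unary.All as All using (All; []; _∷_)
  open import Data.Vec.Relation.Unary.AllPairs using (AllPairs; []; _∷_)
  open import Data.Integer using (+_)

  open CommutativeRing R
  open import Algebra.Properties.Semiring.Exp semiring using (_^_)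
  open IntegerRingSolver R using (solve; _:=_; _:+_; _:*_; :-_; _:-_; con)
  open import Relation.Binary.Reasoning.Setoid setoid

  Distinct : ∀ {n} → Vec Carrier n → Set
  Distinct = AllPairs (λ a b → ¬ a ≈ b)

  -- Coefficient i of a polynomial of degree < n stored at position i.
  eval : ∀ {n} → Vec Carrier n → Carrier → Carrier
  eval []      x = 0#
  eval (c ∷ p) x = c + x * eval p x

  quotient : ∀ {n} → Carrier → Vec Carrier (suc n) → Vec Carrier n
  quotient r (c ∷ [])    = []
  quotient r (c ∷ d ∷ p) = eval (d ∷ p) r ∷ quotient r (d ∷ p)

  eval-quotient : ∀ {n} r (p : Vec Carrier (suc n)) x → eval p x ≈ eval p r + (x - r) * eval (quotient r p) x
  eval-quotient r (c ∷ []) x =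
    solve 3 (λ c x r → c :+ x :* con (+ 0) := (c :+ r :* con (+ 0)) :+ (x :- r) :* con (+ 0)) refl c x r
  eval-quotient r (c ∷ d ∷ p) x = begin
    c + x * eval (d ∷ p) x
      ≈⟨ +-congˡ (*-congˡ (eval-quotient r (d ∷ p) x)) ⟩
    c + x * (e + (x - r) * eval (quotient r (d ∷ p)) x)
      ≈⟨ solve 5 (λ c x r e q → c :+ x :* (e :+ (x :- r) :* q) := (c :+ r :* e) :+ (x :- r) :* (e :+ x :* q))
                 refl c x r e (eval (quotient r (d ∷ p)) x) ⟩
    (c + r * e) + (x - r) * (e + x * eval (quotient r (d ∷ p)) x) ∎
    where
    e : Carrier
    e = eval (d ∷ p) r

  Zero : Carrier → Set
  Zero x = x ≈ 0#

  quotient-zero : ∀ {n} r (p : Vec Carrier (suc n)) → All Zero (quotient r p) → Zero (eval p r) → All Zero p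
  quotient-zero r (c ∷ []) [] p[r]≈0 = trans (solve 2 (λ c r → c := c :+ r :* con (+ 0)) refl c r) p[r]≈0 ∷ []
  quotient-zero r (c ∷ d ∷ p) (e≈0 ∷ q≈0) p[r]≈0 = c≈0 ∷ quotient-zero r (d ∷ p) q≈0 e≈0
    where
    c≈0 : Zero c
    c≈0 = begin
      c                                 ≈⟨ solve 3 (λ c r e → c := (c :+ r :* e) :- r :* e) refl c r (eval (d ∷ p) r) ⟩
      (c + r * eval (d ∷ p) r) - r * eval (d ∷ p) r ≈⟨ +-cong p[r]≈0 (-‿cong (*-congˡ e≈0)) ⟩
      0# - r * 0#                       ≈⟨ solve 1 (λ r → con (+ 0) :- r :* con (+ 0) := con (+ 0)) refl r ⟩
      0#                                ∎

  root-bound : ∀ {n} (rs : Vec Carrier n) (p : Vec Carrier n) → Distinct rs → All (λ r → Zero (eval p r)) rs → All Zero p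
  root-bound []       []      _ _ = []
  root-bound (r ∷ rs) p (r≉rs ∷ distinct) (p[r]≈0 ∷ p[rs]≈0) =
    quotient-zero r p (root-bound rs (quotient r p) distinct (quotient-roots rs r≉rs p[rs]≈0)) p[r]≈0
    where
    quotient-roots : ∀ {m} (ss : Vec Carrier m) → All (λ s → ¬ r ≈ s) ss → All (λ s → Zero (eval p s)) ss →
                     All (λ s → Zero (eval (quotient r p) s)) ss
    quotient-roots []       []            []               = []
    quotient-roots (s ∷ ss) (r≉s ∷ r≉ss) (p[s]≈0 ∷ p[ss]≈0) = *-cancelˡ-nonZero (s - r) _ _ s-r≉0 (begin
        (s - r) * eval (quotient r p) s      ≈⟨ +-identityˡ _ ⟨
        0# + (s - r) * eval (quotient r p) s ≈⟨ +-congʳ p[r]≈0 ⟨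
        eval p r + (s - r) * eval (quotient r p) s ≈⟨ eval-quotient r p s ⟨
        eval p s                             ≈⟨ p[s]≈0 ⟩
        0#                                   ≈⟨ zeroʳ _ ⟨
        (s - r) * 0#                         ∎) ∷ quotient-roots ss r≉ss p[ss]≈0
      where
      s-r≉0 : ¬ s - r ≈ 0#
      s-r≉0 s-r≈0 = r≉s (sym (trans (solve 2 (λ s r → s := (s :- r) :+ r) refl s r) (trans (+-congʳ s-r≈0) (+-identityˡ r))))

  eval-∷ʳ : ∀ {n} (p : Vec Carrier n) c x → eval (p ∷ʳ c) x ≈ eval p x + x ^ n * c
  eval-∷ʳ []      c x = solve 2 (λ c x → c :+ x :* con (+ 0) := con (+ 0) :+ con (+ 1) :* c) refl c x
  eval-∷ʳ {suc n} (d ∷ p) c x = begin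
    d + x * eval (p ∷ʳ c) x              ≈⟨ +-congˡ (*-congˡ (eval-∷ʳ p c x)) ⟩
    d + x * (eval p x + x ^ n * c)       ≈⟨ solve 5 (λ d x e y c → d :+ x :* (e :+ y :* c) := (d :+ x :* e) :+ (x :* y) :* c)
                                                  refl d x (eval p x) (x ^ n) c ⟩
    (d + x * eval p x) + (x * x ^ n) * c ∎

  -- The leading coefficient 1 of a monic polynomial of degree n would vanish if it had n + 1 roots.
  monic-root-bound : ∀ {n} (p : Vec Carrier n) (rs : Vec Carrier (suc n)) → Distinct rs →
                     All (λ r → Zero (eval p r + r ^ n)) rs → 1# ≈ 0#
  monic-root-bound p rs distinct roots = last-zero p (root-bound rs (p ∷ʳ 1#) distinct (All.map
    (λ {r} p[r]+r^n≈0 → trans (eval-∷ʳ p 1# r) (trans (+-congˡ (*-identityʳ _)) p[r]+r^n≈0)) roots))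
    where
    last-zero : ∀ {m} (q : Vec Carrier m) → All Zero (q ∷ʳ 1#) → 1# ≈ 0#
    last-zero []      (1≈0 ∷ []) = 1≈0
    last-zero (_ ∷ q) (_ ∷ zs)   = last-zero q zs

  eval-0s : ∀ m x → eval (replicate m 0#) x ≈ 0#
  eval-0s zero    x = refl
  eval-0s (suc m) x = trans (+-congˡ (*-congˡ (eval-0s m x))) (trans (+-congˡ (zeroʳ x)) (+-identityʳ 0#))

  constant-polynomial : ∀ {n} → 1 ≤ n → (c : Carrier) → Σ[ p ∈ Vec Carrier n ] ∀ x → eval p x ≈ c
  constant-polynomial {suc n} (s≤s _) c = c ∷ replicate n 0# , λ x → trans (+-congˡ (*-congˡ (eval-0s n x))) (trans (+-congˡ (zeroʳ x)) (+-identityʳ c))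

  eval-difference : ∀ {n} (p p′ : Vec Carrier n) x → eval (zipWith _-_ p p′) x ≈ eval p x - eval p′ x
  eval-difference []       []         x = solve 0 (con (+ 0) := con (+ 0) :- con (+ 0)) refl
  eval-difference (c ∷ p) (c′ ∷ p′) x = trans (+-congˡ (*-congˡ (eval-difference p p′ x)))
    (solve 5 (λ c c′ x e e′ → (c :- c′) :+ x :* (e :- e′) := (c :+ x :* e) :- (c′ :+ x :* e′)) refl c c′ x (eval p x) (eval p′ x))

  eval-unique : ∀ {n} (p p′ : Vec Carrier n) (rs : Vec Carrier n) → Distinct rs →
                All (λ r → eval p r ≈ eval p′ r) rs → ∀ x → eval p x ≈ eval p′ x
  eval-unique p p′ rs distinct agree x = begin
    eval p x                           ≈⟨ solve 2 (λ a b → a := (a :- b) :+ b) refl (eval p x) (eval p′ x) ⟩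
    (eval p x - eval p′ x) + eval p′ x ≈⟨ +-congʳ (trans (sym (eval-difference p p′ x)) (eval-zero (zipWith _-_ p p′) x difference-zero)) ⟩
    0# + eval p′ x                     ≈⟨ +-identityˡ _ ⟩
    eval p′ x                          ∎
    where
    eval-zero : ∀ {m} (d : Vec Carrier m) x → All Zero d → Zero (eval d x)
    eval-zero []      x []           = refl
    eval-zero (c ∷ d) x (c≈0 ∷ d≈0) = trans (+-cong c≈0 (*-congˡ (eval-zero d x d≈0))) (trans (+-congˡ (zeroʳ x)) (+-identityʳ 0#))
    difference-zero : All Zero (zipWith _-_ p p′)
    difference-zero = root-bound rs (zipWith _-_ p p′) distinct (All.map
      (λ {r} p[r]≈p′[r] → trans (eval-difference p p′ r) (trans (+-congʳ p[r]≈p′[r]) (-‿inverseʳ _))) agree)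

  negation-polynomial : ∀ {n} → 2 ≤ n → Σ[ p ∈ Vec Carrier n ] ∀ x → eval p x ≈ - x
  negation-polynomial {suc (suc n)} (s≤s (s≤s _)) = 0# ∷ - 1# ∷ replicate n 0# , λ x → begin
    0# + x * (- 1# + x * eval (replicate n 0#) x) ≈⟨ +-congˡ (*-congˡ (+-congˡ (*-congˡ (eval-0s n x)))) ⟩
    0# + x * (- 1# + x * 0#)                      ≈⟨ solve 1 (λ x → con (+ 0) :+ x :* (:- con (+ 1) :+ x :* con (+ 0)) := :- x) refl x ⟩
    - x                                           ∎

module Frobenius (F : FiniteField) (α : FiniteField.Carrier F) (α-nonsquare : NonSquare F α)
                 (q-odd : FiniteField.card F % 2 ≡ 1) where
  open import Data.Nat as ℕ using (ℕ; zero; suc; _%_)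
  open import Data.Nat.Properties using (≤-trans; n≤1+n)
  open import Data.Product using (Σ-syntax; _,_; proj₁; proj₂)
  open import Data.Sum using (inj₁; inj₂)
  open import Data.Vec as Vec using (Vec; []; _∷_; _∷ʳ_; zipWith; fromList)
  open import Data.Vec.Relation.Unary.All as All using (All; []; _∷_)
  open import Data.Vec.Relation.Unary.AllPairs using (AllPairs; []; _∷_)
  open import Data.List using (List)
  import Data.List.Relation.Unary.AllPairs as List
  import Data.List.Relation.Unary.All as List
  open import Data.Integer using (+_)
  open import Data.Empty using (⊥-elim)
  open import Relation.Binary.PropositionalEquality as ≡ using (_≡_)

  open FiniteField F
  open FiniteFieldFacts F
  open Ext F α
  open QuadraticExtension F α α-nonsquare
  open PolynomialRoots K-commutativeRing *K-cancelˡ-nonZero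
  open IntegerRingSolver cring using (solve; _:=_; _:+_; _:*_; :-_; _:-_; con)
  open import Algebra.Properties.CommutativeSemiring.Exp KR.commutativeSemiring using ()
    renaming (_^_ to _^K_; ^-homo-* to ^K-homo-*; ^-distrib-* to ^K-distrib-*; ^-congˡ to ^K-congˡ)
  open import Relation.Binary.Reasoning.Setoid KR.setoid

  powK≈^K : ∀ x n → powK x n ≈K x ^K n
  powK≈^K x zero    = ≈K-refl
  powK≈^K x (suc n) = *K-cong ≈K-refl (powK≈^K x n)

  -- binomial a n = coefficients of (a + X)ⁿ − Xⁿ, using (a + X)ⁿ⁺¹ − Xⁿ⁺¹ = (a + X)((a + X)ⁿ − Xⁿ) + a Xⁿ.
  binomial : K → (n : ℕ) → Vec K n
  binomial a zero    = []
  binomial a (suc n) = zipWith _+K_ (Vec.map (a *K_) (binomial a n) ∷ʳ a) (0K ∷ binomial a n)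

  eval-binomial : ∀ a n x → eval (binomial a n) x +K x ^K n ≈K powK (a +K x) n
  eval-binomial a zero    x = KR.+-identityˡ 1K
  eval-binomial a (suc n) x = begin
    eval (binomial a (suc n)) x +K x ^K suc n
      ≈⟨ +K-cong (eval-zipWith-+ (Vec.map (a *K_) (binomial a n) ∷ʳ a) (0K ∷ binomial a n) x) ≈K-refl ⟩
    (eval (Vec.map (a *K_) (binomial a n) ∷ʳ a) x +K (0K +K x *K E)) +K x *K X
      ≈⟨ +K-cong (+K-cong (≈K-trans (eval-∷ʳ (Vec.map (a *K_) (binomial a n)) a x)
                                    (+K-cong (eval-map-* a (binomial a n) x) ≈K-refl)) ≈K-refl) ≈K-refl ⟩
    ((a *K E +K X *K a) +K (0K +K x *K E)) +K x *K X
      ≈⟨ KS.solve 4 (λ a x E X → ((a KS.:* E KS.:+ X KS.:* a) KS.:+ (KS.con (+ 0) KS.:+ x KS.:* E)) KS.:+ x KS.:* X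
                                KS.:= (a KS.:+ x) KS.:* (E KS.:+ X)) ≈K-refl a x E X ⟩
    (a +K x) *K (E +K X) ≈⟨ *K-cong ≈K-refl (eval-binomial a n x) ⟩
    powK (a +K x) (suc n) ∎
    where
    E X : K
    E = eval (binomial a n) x
    X = x ^K n
    eval-zipWith-+ : ∀ {m} (p p′ : Vec K m) x → eval (zipWith _+K_ p p′) x ≈K eval p x +K eval p′ x
    eval-zipWith-+ []      []        x = ≈K-sym (KR.+-identityˡ 0K)
    eval-zipWith-+ (c ∷ p) (c′ ∷ p′) x = ≈K-trans (+K-cong ≈K-refl (*K-cong ≈K-refl (eval-zipWith-+ p p′ x)))
      (KS.solve 5 (λ c c′ x e e′ → (c KS.:+ c′) KS.:+ x KS.:* (e KS.:+ e′) KS.:= (c KS.:+ x KS.:* e) KS.:+ (c′ KS.:+ x KS.:* e′))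
                  ≈K-refl c c′ x (eval p x) (eval p′ x))
    eval-map-* : ∀ {m} a (p : Vec K m) x → eval (Vec.map (a *K_) p) x ≈K a *K eval p x
    eval-map-* a []      x = ≈K-sym (KR.zeroʳ a)
    eval-map-* a (c ∷ p) x = ≈K-trans (+K-cong ≈K-refl (*K-cong ≈K-refl (eval-map-* a p x)))
      (KS.solve 4 (λ a c x e → a KS.:* c KS.:+ x KS.:* (a KS.:* e) KS.:= a KS.:* (c KS.:+ x KS.:* e)) ≈K-refl a c x (eval p x))

  ι-elements : Vec K q
  ι-elements = Vec.map ι (fromList elements)

  ι-elements-distinct : Distinct ι-elements
  ι-elements-distinct = go elements distinct
    where
    go : ∀ xs → List.AllPairs (λ a b → ¬ a ≈ b) xs → Distinct (Vec.map ι (fromList xs))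
    go List.[]         List.[]         = []
    go (x List.∷ xs) (x≉xs List.∷ d) = ≉-map xs x≉xs ∷ go xs d
      where
      ≉-map : ∀ ys → List.All (λ y → ¬ x ≈ y) ys → All (λ z → ¬ ι x ≈K z) (Vec.map ι (fromList ys))
      ≉-map List.[]       List.[]         = []
      ≉-map (y List.∷ ys) (x≉y List.∷ h) = (λ ιx≈ιy → x≉y (ι-injective ιx≈ιy)) ∷ ≉-map ys h

  All-ι-elements : ∀ {P : K → Set} → (∀ c → P (ι c)) → All P ι-elements
  All-ι-elements {P} P-ι = go elements
    where
    go : ∀ xs → All P (Vec.map ι (fromList xs))
    go List.[]       = []
    go (x List.∷ xs) = P-ι x ∷ go xs

  fermat-ι : ∀ c → ι c ^K q ≈K ι c
  fermat-ι c = ≈K-trans (≈K-sym (powK≈^K (ι c) q)) (≈K-trans (powK-ι c q) (ι-cong (fermat c)))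

  -- (a + X)^q − X^q − a has degree < q and vanishes on F, hence everywhere.
  frobenius-+ : ∀ a t → powK (ι a +K t) q ≈K ι a +K t ^K q
  frobenius-+ a t = begin
    powK (ι a +K t) q                                 ≈⟨ eval-binomial (ι a) q t ⟨
    eval (binomial (ι a) q) t +K t ^K q               ≈⟨ +K-cong (eval-unique (binomial (ι a) q) (proj₁ const-a) ι-elements
                                                          ι-elements-distinct (All-ι-elements on-F) t) ≈K-refl ⟩
    eval (proj₁ const-a) t +K t ^K q                  ≈⟨ +K-cong (proj₂ const-a t) ≈K-refl ⟩
    ι a +K t ^K q                                     ∎
    where
    const-a : Σ[ p ∈ Vec K q ] ∀ x → eval p x ≈K ι a
    const-a = constant-polynomial (≤-trans (n≤1+n 1) 2≤q) (ι a)
    on-F : ∀ c → eval (binomial (ι a) q) (ι c) ≈K eval (proj₁ const-a) (ι c)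
    on-F c = begin
      eval (binomial (ι a) q) (ι c)                   ≈⟨ KS.solve 2 (λ e y → e KS.:= (e KS.:+ y) KS.:- y) ≈K-refl _ (ι c ^K q) ⟩
      (eval (binomial (ι a) q) (ι c) +K ι c ^K q) -K ι c ^K q
        ≈⟨ +K-cong (≈K-trans (eval-binomial (ι a) q (ι c)) (≈K-trans (powK-cong q (≈K-sym (ι-homo-+ a c)))
                     (≈K-trans (powK-ι (a + c) q) (≈K-trans (ι-cong (fermat (a + c))) (ι-homo-+ a c)))))
                   (-K-cong (fermat-ι c)) ⟩
      (ι a +K ι c) -K ι c                             ≈⟨ KS.solve 2 (λ a c → (a KS.:+ c) KS.:- c KS.:= a) ≈K-refl (ι a) (ι c) ⟩
      ι a                                             ≈⟨ proj₂ const-a (ι c) ⟨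
      eval (proj₁ const-a) (ι c)                      ∎

  ι^K : ∀ a n → ι a ^K n ≈K ι (a ^ n)
  ι^K a n = ≈K-trans (≈K-sym (powK≈^K (ι a) n)) (powK-ι a n)

  β^q≈β*ι[α^k] : β ^K q ≈K β *K ι (α ^ k)
  β^q≈β*ι[α^k] = begin
    β ^K q                       ≡⟨ ≡.cong (β ^K_) (q≡1+k+k q-odd) ⟩
    β *K β ^K (k ℕ.+ k)          ≈⟨ *K-cong ≈K-refl (^K-homo-* β k k) ⟩
    β *K (β ^K k *K β ^K k)      ≈⟨ *K-cong ≈K-refl (^K-distrib-* β β k) ⟨
    β *K (β *K β) ^K k           ≈⟨ *K-cong ≈K-refl (^K-congˡ k β*β≈ι-α) ⟩
    β *K ι α ^K k                ≈⟨ *K-cong ≈K-refl (ι^K α k) ⟩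
    β *K ι (α ^ k)               ∎

  -- Euler's criterion for the nonsquare α: if α^k were 1, then β would be a (q+1)-st root of X^q − X.
  α≉0 : ¬ α ≈ 0#
  α≉0 α≈0 = α-nonsquare 0# (trans (zeroʳ 0#) (sym α≈0))

  euler-criterion : α ^ k ≈ - 1#
  euler-criterion with x*y≈0⇒x≈0⊎y≈0 {α ^ k - 1#} {α ^ k + 1#}
    (trans (solve 1 (λ e → (e :- con (+ 1)) :* (e :+ con (+ 1)) := e :* e :- con (+ 1)) refl (α ^ k))
           (trans (+-congʳ (a^k*a^k≈1 q-odd α α≉0)) (-‿inverseʳ 1#)))
  ... | inj₂ α^k+1≈0 = trans (solve 1 (λ e → e := (e :+ con (+ 1)) :- con (+ 1)) refl (α ^ k))
                            (trans (+-congʳ α^k+1≈0) (+-identityˡ (- 1#)))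
  ... | inj₁ α^k-1≈0 = ⊥-elim (1≉0 (proj₁ (monic-root-bound (proj₁ -X) (β ∷ ι-elements) (β≉ι-elements ∷ ι-elements-distinct)
                                       (root β β^q≈β ∷ All-ι-elements (λ c → root (ι c) (fermat-ι c))))))
    where
    α^k≈1 : α ^ k ≈ 1#
    α^k≈1 = trans (solve 1 (λ e → e := (e :- con (+ 1)) :+ con (+ 1)) refl (α ^ k)) (trans (+-congʳ α^k-1≈0) (+-identityˡ 1#))
    β^q≈β : β ^K q ≈K β
    β^q≈β = ≈K-trans β^q≈β*ι[α^k] (≈K-trans (*K-cong ≈K-refl (ι-cong α^k≈1)) (KR.*-identityʳ β))
    -X : Σ[ p ∈ Vec K q ] ∀ x → eval p x ≈K -K x
    -X = negation-polynomial 2≤q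
    root : ∀ r → r ^K q ≈K r → eval (proj₁ -X) r +K r ^K q ≈K 0K
    root r r^q≈r = ≈K-trans (+K-cong (proj₂ -X r) r^q≈r) (KR.-‿inverseˡ r)
    β≉ι-elements : All (λ z → ¬ β ≈K z) ι-elements
    β≉ι-elements = All-ι-elements (λ c β≈ιc → 1≉0 (proj₂ β≈ιc))

  β^q≈-β : β ^K q ≈K -K β
  β^q≈-β = ≈K-trans β^q≈β*ι[α^k] (≈K-trans (*K-cong ≈K-refl (≈K-trans (ι-cong euler-criterion) (ι-‿homo 1#)))
             (KS.solve 1 (λ b → b KS.:* KS.:- KS.con (+ 1) KS.:= KS.:- b) ≈K-refl β))

  conj≈σ : ∀ x → conj x ≈K σ x
  conj≈σ (a , b) = begin
    powK (a , b) q                      ≈⟨ powK-cong q (≈ι+β*ι a b) ⟩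
    powK (ι a +K β *K ι b) q            ≈⟨ frobenius-+ a (β *K ι b) ⟩
    ι a +K (β *K ι b) ^K q              ≈⟨ +K-cong ≈K-refl (^K-distrib-* β (ι b) q) ⟩
    ι a +K β ^K q *K ι b ^K q           ≈⟨ +K-cong ≈K-refl (*K-cong β^q≈-β (fermat-ι b)) ⟩
    ι a +K (-K β) *K ι b                ≈⟨ solve 3 (λ a b g → a :+ (:- con (+ 0) :* b :+ g :* (:- con (+ 1) :* con (+ 0))) := a) refl a b α
                                         , solve 1 (λ b → con (+ 0) :+ (:- con (+ 0) :* con (+ 0) :+ :- con (+ 1) :* b) := :- b) refl b ⟩
    σ (a , b)                           ∎

module Squares (F : FiniteField) (q-odd : FiniteField.card F % 2 ≡ 1) where
  open import Data.Nat as ℕ using (ℕ; zero; suc; _%_)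
  open import Data.List using (List; []; _∷_)
  open import Data.List.Relation.Unary.Any using (here; there)
  open import Data.List.Relation.Unary.All using (All; []; _∷_)
  open import Data.Product using (Σ-syntax; _,_; proj₁; proj₂)
  open import Data.Sum using (_⊎_; inj₁; inj₂)
  open import Data.Empty using (⊥-elim)
  open import Data.Integer using (+_)
  open import Relation.Nullary using (¬_; yes; no)
  open import Relation.Binary.PropositionalEquality as ≡ using (_≡_)

  open FiniteField F
  open FiniteFieldFacts F
  open IntegerRingSolver cring using (solve; _:=_; _:+_; _:*_; :-_; _:-_; con; fromℕ; fromℕ-suc)
  open import Data.List.Membership.Setoid setoid using (_∈_)
  open import Relation.Binary.Reasoning.Setoid setoid

  IsSquare : Carrier → Set
  IsSquare c = Σ[ s ∈ Carrier ] s * s ≈ c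

  IsSquare-resp : ∀ {a b} → a ≈ b → IsSquare a → IsSquare b
  IsSquare-resp a≈b (s , s*s≈a) = s , trans s*s≈a a≈b

  NonSquare-resp : ∀ {a b} → a ≈ b → NonSquare F a → NonSquare F b
  NonSquare-resp a≈b a-nonsquare s s*s≈b = a-nonsquare s (trans s*s≈b (sym a≈b))

  nonsquare≉0 : ∀ {c} → NonSquare F c → ¬ c ≈ 0#
  nonsquare≉0 c-nonsquare c≈0 = c-nonsquare 0# (trans (zeroʳ 0#) (sym c≈0))

  square? : ∀ c → IsSquare c ⊎ NonSquare F c
  square? c with search elements
    where
    search : ∀ xs → IsSquare c ⊎ All (λ s → ¬ s * s ≈ c) xs
    search []       = inj₂ []
    search (x ∷ xs) with x * x ≟ c | search xs
    ... | yes x*x≈c | _             = inj₁ (x , x*x≈c)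
    ... | no _      | inj₁ square   = inj₁ square
    ... | no x*x≉c  | inj₂ ≉c       = inj₂ (x*x≉c ∷ ≉c)
  ... | inj₁ square = inj₁ square
  ... | inj₂ ≉c     = inj₂ (λ s → go (complete s) ≉c)
    where
    go : ∀ {s xs} → s ∈ xs → All (λ s → ¬ s * s ≈ c) xs → ¬ s * s ≈ c
    go (here s≈x)   (x*x≉c ∷ _) s*s≈c = x*x≉c (trans (*-cong (sym s≈x) (sym s≈x)) s*s≈c)
    go (there s∈xs) (_ ∷ ≉c)    = go s∈xs ≉c

  1≉-1 : ¬ 1# ≈ - 1#
  1≉-1 1≈-1 = 2≉0 q-odd (trans (+-congˡ 1≈-1) (-‿inverseʳ 1#))

  -1≉0 : ¬ - 1# ≈ 0#
  -1≉0 -1≈0 = 1≉0 (trans (solve 0 (con (+ 1) := :- (:- con (+ 1))) refl) (trans (-‿cong -1≈0) (solve 0 (:- con (+ 0) := con (+ 0)) refl)))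

  nonsquare^k≈-1 : ∀ {c} → NonSquare F c → c ^ k ≈ - 1#
  nonsquare^k≈-1 {c} c-nonsquare = Frobenius.euler-criterion F c c-nonsquare q-odd

  -- The converse half of Euler's criterion: nonsquares have c^k = −1 ≠ 1.
  ^k≈1⇒square : ∀ {c} → c ^ k ≈ 1# → IsSquare c
  ^k≈1⇒square {c} c^k≈1 with square? c
  ... | inj₁ square      = square
  ... | inj₂ c-nonsquare = ⊥-elim (1≉-1 (trans (sym c^k≈1) (nonsquare^k≈-1 c-nonsquare)))

  nonsquare*nonsquare-square : ∀ {a b} → NonSquare F a → NonSquare F b → IsSquare (a * b)
  nonsquare*nonsquare-square {a} {b} a-nonsquare b-nonsquare = ^k≈1⇒square (begin
    (a * b) ^ k          ≈⟨ ^-distrib-* a b k ⟩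
    a ^ k * b ^ k        ≈⟨ *-cong (nonsquare^k≈-1 a-nonsquare) (nonsquare^k≈-1 b-nonsquare) ⟩
    - 1# * - 1#          ≈⟨ solve 0 (:- con (+ 1) :* :- con (+ 1) := con (+ 1)) refl ⟩
    1#                   ∎)

  square*nonsquare-nonsquare : ∀ {a b} → ¬ a ≈ 0# → IsSquare a → NonSquare F b → NonSquare F (a * b)
  square*nonsquare-nonsquare {a} {b} a≉0 (r , r*r≈a) b-nonsquare s s*s≈ab = b-nonsquare (s * r ⁻¹) (*-cancelˡ a≉0 (begin
    a * ((s * r ⁻¹) * (s * r ⁻¹))      ≈⟨ *-congʳ r*r≈a ⟨
    (r * r) * ((s * r ⁻¹) * (s * r ⁻¹)) ≈⟨ solve 3 (λ r s i → (r :* r) :* ((s :* i) :* (s :* i)) := (s :* s) :* ((r :* i) :* (r :* i))) refl r s (r ⁻¹) ⟩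
    (s * s) * ((r * r ⁻¹) * (r * r ⁻¹)) ≈⟨ *-cong s*s≈ab (*-cong (⁻¹-inverse r r≉0) (⁻¹-inverse r r≉0)) ⟩
    (a * b) * (1# * 1#)                 ≈⟨ solve 2 (λ a b → (a :* b) :* (con (+ 1) :* con (+ 1)) := a :* b) refl a b ⟩
    a * b                               ∎))
    where
    r≉0 : ¬ r ≈ 0#
    r≉0 r≈0 = a≉0 (trans (sym r*r≈a) (trans (*-congʳ r≈0) (zeroˡ r)))

  nonsquare-ratio : ∀ {a b} → NonSquare F a → NonSquare F b → Σ[ s ∈ Carrier ] a ≈ s * s * b
  nonsquare-ratio {a} {b} a-nonsquare b-nonsquare = e * b ⁻¹ , (begin
    a                              ≈⟨ solve 2 (λ a i → a := a :* con (+ 1) :* con (+ 1)) refl a (b ⁻¹) ⟩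
    a * 1# * 1#                    ≈⟨ *-cong (*-congˡ (sym b*b⁻¹≈1)) (sym b*b⁻¹≈1) ⟩
    a * (b * b ⁻¹) * (b * b ⁻¹)    ≈⟨ solve 3 (λ a b i → a :* (b :* i) :* (b :* i) := (a :* b) :* (i :* i) :* b) refl a b (b ⁻¹) ⟩
    (a * b) * (b ⁻¹ * b ⁻¹) * b    ≈⟨ *-congʳ (*-congʳ e*e≈ab) ⟨
    (e * e) * (b ⁻¹ * b ⁻¹) * b    ≈⟨ *-congʳ (solve 2 (λ e i → (e :* e) :* (i :* i) := (e :* i) :* (e :* i)) refl e (b ⁻¹)) ⟩
    e * b ⁻¹ * (e * b ⁻¹) * b      ∎)
    where
    e : Carrier
    e = proj₁ (nonsquare*nonsquare-square a-nonsquare b-nonsquare)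
    e*e≈ab : e * e ≈ a * b
    e*e≈ab = proj₂ (nonsquare*nonsquare-square a-nonsquare b-nonsquare)
    b*b⁻¹≈1 : b * b ⁻¹ ≈ 1#
    b*b⁻¹≈1 = ⁻¹-inverse b (nonsquare≉0 b-nonsquare)

  -- If every 1 + t² were a square, induction would make every n·1 a square, among them (q − 1)·1 = −1.
  -1-nonsquare⇒1+t²-nonsquare : NonSquare F (- 1#) → Σ[ t ∈ Carrier ] NonSquare F (1# + t * t)
  -1-nonsquare⇒1+t²-nonsquare -1-nonsquare with search elements
    where
    search : ∀ xs → (Σ[ t ∈ Carrier ] NonSquare F (1# + t * t)) ⊎ All (λ t → IsSquare (1# + t * t)) xs
    search []       = inj₂ []
    search (x ∷ xs) with square? (1# + x * x) | search xs
    ... | inj₂ nonsquare | _          = inj₁ (x , nonsquare)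
    ... | inj₁ _         | inj₁ found = inj₁ found
    ... | inj₁ square    | inj₂ all   = inj₂ (square ∷ all)
  ... | inj₁ found = found
  ... | inj₂ all   = ⊥-elim (-1-nonsquare (proj₁ -1-square) (proj₂ -1-square))
    where
    1+t²-square : ∀ t → IsSquare (1# + t * t)
    1+t²-square t = go (complete t) all
      where
      go : ∀ {xs} → t ∈ xs → All (λ t → IsSquare (1# + t * t)) xs → IsSquare (1# + t * t)
      go (here t≈x)   (square ∷ _) = IsSquare-resp (+-congˡ (*-cong (sym t≈x) (sym t≈x))) square
      go (there t∈xs) (_ ∷ all)    = go t∈xs all
    n×1-square : ∀ n → IsSquare (fromℕ n)
    n×1-square zero = 0# , zeroʳ 0#
    n×1-square (suc n) with n×1-square n
    ... | s , s*s≈n = IsSquare-resp (trans (+-congˡ s*s≈n) (sym (fromℕ-suc n))) (1+t²-square s)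
    -1-square : IsSquare (- 1#)
    -1-square = IsSquare-resp (begin
      fromℕ (k ℕ.+ k)                 ≈⟨ solve 1 (λ x → x := (con (+ 1) :+ x) :- con (+ 1)) refl (fromℕ (k ℕ.+ k)) ⟩
      (1# + fromℕ (k ℕ.+ k)) - 1#     ≈⟨ +-congʳ (fromℕ-suc (k ℕ.+ k)) ⟨
      fromℕ (suc (k ℕ.+ k)) - 1#      ≡⟨ ≡.cong (λ n → fromℕ n - 1#) (q≡1+k+k q-odd) ⟨
      fromℕ q - 1#                    ≈⟨ +-congʳ q×1≈0 ⟩
      0# - 1#                         ≈⟨ +-identityˡ _ ⟩
      - 1#                            ∎) (n×1-square (k ℕ.+ k))

  norm-surjective : ∀ {α} → NonSquare F α → ∀ m → Σ[ a ∈ Carrier ] Σ[ b ∈ Carrier ] a * a - α * (b * b) ≈ m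
  norm-surjective {α} α-nonsquare m with square? m | square? (- 1#)
  ... | inj₁ (s , s*s≈m) | _ = s , 0# , trans (solve 2 (λ s a → s :* s :- a :* (con (+ 0) :* con (+ 0)) := s :* s) refl s α) s*s≈m
  ... | inj₂ m-nonsquare | inj₁ -1-square = 0# , s , (begin
    0# * 0# - α * (s * s)     ≈⟨ solve 2 (λ a s → con (+ 0) :* con (+ 0) :- a :* (s :* s) := s :* s :* (:- con (+ 1) :* a)) refl α s ⟩
    s * s * (- 1# * α)        ≈⟨ m≈s*s*[-α] ⟨
    m                         ∎)
    where
    -α-nonsquare : NonSquare F (- 1# * α)
    -α-nonsquare = square*nonsquare-nonsquare -1≉0 -1-square α-nonsquare
    s : Carrier
    s = proj₁ (nonsquare-ratio m-nonsquare -α-nonsquare)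
    m≈s*s*[-α] : m ≈ s * s * (- 1# * α)
    m≈s*s*[-α] = proj₂ (nonsquare-ratio m-nonsquare -α-nonsquare)
  ... | inj₂ m-nonsquare | inj₂ -1-nonsquare = s , s * t * r , (begin
    s * s - α * ((s * t * r) * (s * t * r)) ≈⟨ solve 4 (λ s t r a → s :* s :- a :* ((s :* t :* r) :* (s :* t :* r))
                                                   := s :* s :* (con (+ 1) :- t :* t :* (r :* r :* a))) refl s t r α ⟩
    s * s * (1# - t * t * (r * r * α))      ≈⟨ *-congˡ (+-congˡ (-‿cong (*-congˡ -1≈r*r*α))) ⟨
    s * s * (1# - t * t * - 1#)             ≈⟨ *-congˡ (solve 1 (λ t → con (+ 1) :- t :* t :* :- con (+ 1) := con (+ 1) :+ t :* t) refl t) ⟩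
    s * s * (1# + t * t)                    ≈⟨ m≈s*s*[1+t²] ⟨
    m                                       ∎)
    where
    t : Carrier
    t = proj₁ (-1-nonsquare⇒1+t²-nonsquare -1-nonsquare)
    1+t²-nonsquare : NonSquare F (1# + t * t)
    1+t²-nonsquare = proj₂ (-1-nonsquare⇒1+t²-nonsquare -1-nonsquare)
    s r : Carrier
    s = proj₁ (nonsquare-ratio m-nonsquare 1+t²-nonsquare)
    r = proj₁ (nonsquare-ratio -1-nonsquare α-nonsquare)
    m≈s*s*[1+t²] : m ≈ s * s * (1# + t * t)
    m≈s*s*[1+t²] = proj₂ (nonsquare-ratio m-nonsquare 1+t²-nonsquare)
    -1≈r*r*α : - 1# ≈ r * r * α
    -1≈r*r*α = proj₂ (nonsquare-ratio -1-nonsquare α-nonsquare)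

module DualCurve (F : FiniteField) (q-odd : FiniteField.card F % 2 ≡ 1)
                 (α : FiniteField.Carrier F) (α-nonsquare : NonSquare F α) (ζ : Ext.K F α) where
  open import Data.Fin using (#_)
  open import Data.Product using (_,_; proj₁; proj₂)
  open import Data.Vec as Vec using (Vec; []; _∷_)
  open import Data.Vec.Relation.Binary.Pointwise.Inductive using (Pointwise; []; _∷_)
  open import Data.Integer using (+_)
  open import Relation.Binary.PropositionalEquality as ≡ using (_≡_)

  open FiniteField F
  open FiniteFieldFacts F
  open Ext F α
  open QuadraticExtension F α α-nonsquare
  open Frobenius F α α-nonsquare q-odd using (conj≈σ)
  open IntegerRingSolver cring using (solve; _:=_; _:+_; _:*_; :-_; _:-_; con)
  open import Algebra.Properties.Ring (CommutativeRing.ring cring) using (-‿involutive; -0#≈0#)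
  open import Relation.Binary.Reasoning.Setoid setoid

  n : Carrier
  n = norm ζ

  2# : Carrier
  2# = 1# + 1#

  disc : Carrier → Carrier → Carrier
  disc a b = (2# * a + n) * (2# * a + n) - 2# * 2# * (n + 1#) * (a * a - α * (b * b))

  -- dualEval (FA (Aζ ζ)) a b 1, as a polynomial in e = 1/2, g = 1/(2β), the entries c₁ = conj 1, c₀ = conj 0,
  -- z = ζ, z̄ = conj ζ of the conjugate transpose, and a, b.
  dual-polynomial : ∀ {m} → (e g c₁ c₀ z z̄ a b : KS.Polynomial m) → KS.Polynomial m
  dual-polynomial {m} e g c₁ c₀ z z̄ a b =
    (A11 KS.:* (a KS.:* a)) KS.:+ (A22 KS.:* (b KS.:* b)) KS.:+ (A33 KS.:* (one KS.:* one))
    KS.:+ ((one KS.:+ one) KS.:* ((A12 KS.:* (a KS.:* b)) KS.:+ (A13 KS.:* (a KS.:* one)) KS.:+ (A23 KS.:* (b KS.:* one))))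
    where
    one nil p11 p12 p21 p22 q11 q12 q21 q22 s11 s22 s12 s13 s23 A11 A22 A33 A12 A13 A23 : KS.Polynomial m
    one  = KS.con (+ 1)
    nil  = KS.con (+ 0)
    p11 = e KS.:* (one KS.:+ c₁)
    p12 = e KS.:* (z KS.:+ c₀)
    p21 = e KS.:* (nil KS.:+ z̄)
    p22 = e KS.:* (nil KS.:+ c₀)
    q11 = g KS.:* (one KS.:- c₁)
    q12 = g KS.:* (z KS.:- c₀)
    q21 = g KS.:* (nil KS.:- z̄)
    q22 = g KS.:* (nil KS.:- c₀)
    s11 = (p11 KS.:* p22) KS.:- (p12 KS.:* p21)
    s22 = (q11 KS.:* q22) KS.:- (q12 KS.:* q21)
    s12 = e KS.:* (((p11 KS.:* q22) KS.:+ (q11 KS.:* p22)) KS.:- ((p12 KS.:* q21) KS.:+ (q12 KS.:* p21)))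
    s13 = e KS.:* (p11 KS.:+ p22)
    s23 = e KS.:* (q11 KS.:+ q22)
    A11 = (s22 KS.:* one) KS.:- (s23 KS.:* s23)
    A22 = (s11 KS.:* one) KS.:- (s13 KS.:* s13)
    A33 = (s11 KS.:* s22) KS.:- (s12 KS.:* s12)
    A12 = (s13 KS.:* s23) KS.:- (s12 KS.:* one)
    A13 = (s12 KS.:* s23) KS.:- (s13 KS.:* s22)
    A23 = (s12 KS.:* s13) KS.:- (s11 KS.:* s23)

  -- Up to the factor 4(2β)², the dual polynomial with u = 2e, G = 2βg, N = z z̄, S = β².
  dual-normal-form : ∀ {m} → (u G N S a b : KS.Polynomial m) → KS.Polynomial m
  dual-normal-form u G N S a b =
    KS.con (+ 4) KS.:* G KS.:* G KS.:* N KS.:* a KS.:* a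
    KS.:- KS.con (+ 4) KS.:* u KS.:* u KS.:* S KS.:* (N KS.:+ u KS.:* u) KS.:* b KS.:* b
    KS.:- u KS.:* u KS.:* G KS.:* G KS.:* N KS.:* N
    KS.:- KS.con (+ 4) KS.:* u KS.:* u KS.:* G KS.:* G KS.:* N KS.:* a

  private
    v : ∀ {m} → Data.Fin.Fin m → KS.Polynomial m
    v = KS.var

    2β : K
    2β = two *K β

    scale : K
    scale = KS.fromℤ (+ 4) *K 2β *K 2β

    two≉0 : ¬ two ≈K 0K
    two≉0 two≈0 = 2≉0 q-odd (proj₁ two≈0)

    2β≉0 : ¬ 2β ≈K 0K
    2β≉0 = x*Ky≉0 two≉0 (λ β≈0 → 1≉0 (proj₂ β≈0))

    scale≉0 : ¬ scale ≈K 0K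
    scale≉0 = x*Ky≉0 (x*Ky≉0 4≉0 2β≉0) 2β≉0
      where
      4≉0 : ¬ KS.fromℤ (+ 4) ≈K 0K
      4≉0 4≈0 = x*Ky≉0 two≉0 two≉0
        (≈K-trans (KS.solve 0 ((KS.con (+ 1) KS.:+ KS.con (+ 1)) KS.:* (KS.con (+ 1) KS.:+ KS.con (+ 1)) KS.:= KS.con (+ 4)) ≈K-refl) 4≈0)

    dual-normal-form≈disc : ∀ a b → FS.⟦ toF (dual-normal-form (v (# 0)) (v (# 1)) (v (# 2)) (v (# 3)) (v (# 4)) (v (# 5))) ⟧
                                       (1# ∷ 1# ∷ n ∷ α ∷ a ∷ b ∷ []) ≈ - disc a b
    dual-normal-form≈disc a b = FS.solve 4 (λ n α a b →
      FS.con (+ 4) FS.:* FS.con (+ 1) FS.:* FS.con (+ 1) FS.:* n FS.:* a FS.:* a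
      FS.:- FS.con (+ 4) FS.:* FS.con (+ 1) FS.:* FS.con (+ 1) FS.:* α FS.:* (n FS.:+ FS.con (+ 1) FS.:* FS.con (+ 1)) FS.:* b FS.:* b
      FS.:- FS.con (+ 1) FS.:* FS.con (+ 1) FS.:* FS.con (+ 1) FS.:* FS.con (+ 1) FS.:* n FS.:* n
      FS.:- FS.con (+ 4) FS.:* FS.con (+ 1) FS.:* FS.con (+ 1) FS.:* FS.con (+ 1) FS.:* FS.con (+ 1) FS.:* n FS.:* a
      FS.:= FS.:- ((FS.con (+ 2) FS.:* a FS.:+ n) FS.:* (FS.con (+ 2) FS.:* a FS.:+ n)
                   FS.:- FS.con (+ 2) FS.:* FS.con (+ 2) FS.:* (n FS.:+ FS.con (+ 1)) FS.:* (a FS.:* a FS.:- α FS.:* (b FS.:* b))))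
      refl n α a b

    scale*dual≈ι-disc : ∀ a b → scale *K dualEval (FA (Aζ ζ)) (ι a) (ι b) 1K ≈K ι (- disc a b)
    scale*dual≈ι-disc a b =
      ≈K-trans (*K-cong ≈K-refl (KS.⟦⟧-cong (dual-polynomial (v (# 0)) (v (# 1)) (v (# 2)) (v (# 3)) (v (# 4)) (v (# 5)) (v (# 6)) (v (# 7)))
                                             conj-entries))
      (≈K-trans (KS.prove ρ (scale-polynomial KS.:* dual-polynomial (v (# 0)) (v (# 1)) (KS.con (+ 1)) (KS.con (+ 0)) (v (# 4)) (v (# 5)) (v (# 6)) (v (# 7)))
                            (dual-normal-form (KS.con (+ 2) KS.:* v (# 0)) (KS.con (+ 2) KS.:* v (# 8) KS.:* v (# 1))
                                              (v (# 4) KS.:* v (# 5)) (v (# 8) KS.:* v (# 8)) (v (# 6)) (v (# 7))) ≈K-refl)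
      (≈K-trans (KS.⟦⟧-cong (dual-normal-form (v (# 0)) (v (# 1)) (v (# 2)) (v (# 3)) (v (# 4)) (v (# 5))) normalised-entries)
      (≈K-trans (ι-⟦⟧ (dual-normal-form (v (# 0)) (v (# 1)) (v (# 2)) (v (# 3)) (v (# 4)) (v (# 5))) (1# ∷ 1# ∷ n ∷ α ∷ a ∷ b ∷ []))
                (ι-cong (dual-normal-form≈disc a b)))))
      where
      ρ : Vec K 9
      ρ = invK two ∷ invK 2β ∷ 1K ∷ 0K ∷ ζ ∷ σ ζ ∷ ι a ∷ ι b ∷ β ∷ []
      scale-polynomial : KS.Polynomial 9
      scale-polynomial = KS.con (+ 4) KS.:* (KS.con (+ 2) KS.:* v (# 8)) KS.:* (KS.con (+ 2) KS.:* v (# 8))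
      conj-entries : Pointwise _≈K_ (invK two ∷ invK 2β ∷ conj 1K ∷ conj 0K ∷ ζ ∷ conj ζ ∷ ι a ∷ ι b ∷ β ∷ []) ρ
      conj-entries = ≈K-refl ∷ ≈K-refl ∷ ≈K-trans (conj≈σ 1K) (σ-ι 1#) ∷ ≈K-trans (conj≈σ 0K) (σ-ι 0#)
                   ∷ ≈K-refl ∷ conj≈σ ζ ∷ ≈K-refl ∷ ≈K-refl ∷ ≈K-refl ∷ []
      normalised-entries : Pointwise _≈K_ (two *K invK two ∷ 2β *K invK 2β ∷ ζ *K σ ζ ∷ β *K β ∷ ι a ∷ ι b ∷ [])
                                          (Vec.map ι (1# ∷ 1# ∷ n ∷ α ∷ a ∷ b ∷ []))
      normalised-entries = invK-inverseʳ two two≉0 ∷ invK-inverseʳ 2β 2β≉0 ∷ x*σx≈ι-norm ζ ∷ β*β≈ι-α ∷ ≈K-refl ∷ ≈K-refl ∷ []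

  disc-cong : ∀ {a a′ b b′} → a ≈ a′ → b ≈ b′ → disc a b ≈ disc a′ b′
  disc-cong a≈a′ b≈b′ = +-cong (*-cong (+-congʳ (*-congˡ a≈a′)) (+-congʳ (*-congˡ a≈a′)))
                               (-‿cong (*-congˡ (+-cong (*-cong a≈a′ a≈a′) (-‿cong (*-congˡ (*-cong b≈b′ b≈b′))))))

  InDual⇒disc≈0 : ∀ {x y} → InDual (Aζ ζ) (x , y) → disc x y ≈ 0#
  InDual⇒disc≈0 {x} {y} ((a , b) , xy≈a+βb , dual≈0) = begin
    disc x y              ≈⟨ disc-cong (proj₁ xy≈ab) (proj₂ xy≈ab) ⟩
    disc a b              ≈⟨ -‿involutive (disc a b) ⟨
    - - disc a b          ≈⟨ -‿cong (ι-injective (≈K-trans (≈K-sym (scale*dual≈ι-disc a b))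
                                       (≈K-trans (*K-cong ≈K-refl dual≈0) (KR.zeroʳ scale)))) ⟩
    - 0#                  ≈⟨ -0#≈0# ⟩
    0#                    ∎
    where
    xy≈ab : (x , y) ≈K (a , b)
    xy≈ab = ≈K-trans xy≈a+βb (≈K-sym (≈ι+β*ι a b))

  disc≈0⇒InDual : ∀ x y → disc x y ≈ 0# → InDual (Aζ ζ) (x , y)
  disc≈0⇒InDual x y disc≈0 = (x , y) , ≈ι+β*ι x y ,
    *K-cancelˡ-nonZero scale _ _ scale≉0 (≈K-trans (scale*dual≈ι-disc x y)
      (≈K-trans (ι-cong (trans (-‿cong disc≈0) -0#≈0#)) (≈K-sym (KR.zeroʳ scale))))

module NumericalRange (F : FiniteField) (q-odd : FiniteField.card F % 2 ≡ 1)
                      (α : FiniteField.Carrier F) (α-nonsquare : NonSquare F α) (ζ : Ext.K F α) where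
  open import Data.Product using (Σ-syntax; _,_; proj₁; proj₂)
  open import Data.Integer using (+_)
  open import Relation.Nullary.Decidable using (toSum)
  open import Data.Sum using ([_,_]′)

  open FiniteField F
  open FiniteFieldFacts F
  open Ext F α
  open QuadraticExtension F α α-nonsquare
  open Frobenius F α α-nonsquare q-odd using (conj≈σ)
  open Squares F q-odd using (norm-surjective)
  open IntegerRingSolver cring using (solve; _:=_; _:+_; _:*_; :-_; _:-_; con)
  open import Relation.Binary.Reasoning.Setoid setoid

  -- A unit vector v with m = |v₁|² gives ⟨Av, v⟩ − m = ζ v̄₁ v₂, of norm |ζ|² m (1 − m).
  W-condition : K → Carrier → Set
  W-condition (x , y) m = (x - m) * (x - m) - α * (y * y) ≈ norm ζ * (m * (1# - m))

  σx*x≈ι-norm : ∀ x → σ x *K x ≈K ι (norm x)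
  σx*x≈ι-norm x = ≈K-trans (KR.*-comm (σ x) x) (x*σx≈ι-norm x)

  inner-self : ∀ v₁ v₂ → inner (v₁ , v₂) (v₁ , v₂) ≈K ι (norm v₁ + norm v₂)
  inner-self v₁ v₂ = ≈K-trans (+K-cong (*K-cong (conj≈σ v₁) ≈K-refl) (*K-cong (conj≈σ v₂) ≈K-refl))
    (≈K-trans (+K-cong (σx*x≈ι-norm v₁) (σx*x≈ι-norm v₂)) (≈K-sym (ι-homo-+ _ _)))

  inner-Aζ : ∀ v₁ v₂ → inner (apply (Aζ ζ) (v₁ , v₂)) (v₁ , v₂) ≈K ι (norm v₁) +K (ζ *K σ v₁) *K v₂
  inner-Aζ v₁ v₂ = ≈K-trans (+K-cong (*K-cong (conj≈σ v₁) ≈K-refl) (*K-cong (conj≈σ v₂) ≈K-refl))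
    (≈K-trans (KS.solve 5 (λ s₁ v₁ z s₂ v₂ → s₁ KS.:* (KS.con (+ 1) KS.:* v₁ KS.:+ z KS.:* v₂)
                                           KS.:+ s₂ KS.:* (KS.con (+ 0) KS.:* v₁ KS.:+ KS.con (+ 0) KS.:* v₂)
                                         KS.:= s₁ KS.:* v₁ KS.:+ (z KS.:* s₁) KS.:* v₂) ≈K-refl (σ v₁) v₁ ζ (σ v₂) v₂)
              (+K-cong (σx*x≈ι-norm v₁) ≈K-refl))

  norm-−ι : ∀ x y m → norm ((x , y) -K ι m) ≈ (x - m) * (x - m) - α * (y * y)
  norm-−ι x y m = solve 4 (λ x y m g → (x :+ :- m) :* (x :+ :- m) :- g :* ((y :+ :- con (+ 0)) :* (y :+ :- con (+ 0)))
                                     := (x :- m) :* (x :- m) :- g :* (y :* y)) refl x y m α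

  InW⇒W-condition : ∀ {x y} → InW (Aζ ζ) (x , y) → Σ[ m ∈ Carrier ] W-condition (x , y) m
  InW⇒W-condition {x} {y} ((v₁ , v₂) , ⟨v,v⟩≈1 , ⟨Av,v⟩≈z) = m , (begin
    (x - m) * (x - m) - α * (y * y)     ≈⟨ norm-−ι x y m ⟨
    norm ((x , y) -K ι m)               ≈⟨ norm-cong z-m≈ζσv₁v₂ ⟩
    norm ((ζ *K σ v₁) *K v₂)            ≈⟨ trans (norm-homo-* _ v₂) (*-congʳ (norm-homo-* ζ (σ v₁))) ⟩
    (norm ζ * norm (σ v₁)) * norm v₂    ≈⟨ *-cong (*-congˡ (norm-σ v₁)) |v₂|²≈1-m ⟩
    (norm ζ * m) * (1# - m)             ≈⟨ *-assoc _ _ _ ⟩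
    norm ζ * (m * (1# - m))             ∎)
    where
    m : Carrier
    m = norm v₁
    |v₂|²≈1-m : norm v₂ ≈ 1# - m
    |v₂|²≈1-m = trans (solve 2 (λ m m₂ → m₂ := (m :+ m₂) :- m) refl m (norm v₂))
                      (+-congʳ (ι-injective (≈K-trans (≈K-sym (inner-self v₁ v₂)) ⟨v,v⟩≈1)))
    z-m≈ζσv₁v₂ : (x , y) -K ι m ≈K (ζ *K σ v₁) *K v₂
    z-m≈ζσv₁v₂ = ≈K-trans (+K-cong (≈K-trans (≈K-sym ⟨Av,v⟩≈z) (inner-Aζ v₁ v₂)) ≈K-refl)
                   (KS.solve 2 (λ a w → (a KS.:+ w) KS.:- a KS.:= w) ≈K-refl (ι m) ((ζ *K σ v₁) *K v₂))

  witness⇒InW : ∀ {z} v₁ v₂ → norm v₁ + norm v₂ ≈ 1# → ι (norm v₁) +K (ζ *K σ v₁) *K v₂ ≈K z → InW (Aζ ζ) z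
  witness⇒InW v₁ v₂ |v|²≈1 value≈z =
    (v₁ , v₂) , ≈K-trans (inner-self v₁ v₂) (ι-cong |v|²≈1) , ≈K-trans (inner-Aζ v₁ v₂) value≈z

  m≈0⇒InW : ∀ x y m → W-condition (x , y) m → m ≈ 0# → InW (Aζ ζ) (x , y)
  m≈0⇒InW x y m condition m≈0 = witness⇒InW 0K 1K
    (solve 1 (λ g → (con (+ 0) :* con (+ 0) :- g :* (con (+ 0) :* con (+ 0)))
                    :+ (con (+ 1) :* con (+ 1) :- g :* (con (+ 0) :* con (+ 0))) := con (+ 1)) refl α)
    (≈K-trans (+K-cong ≈K-refl (*K-cong (*K-cong ≈K-refl (σ-ι 0#)) ≈K-refl))
    (≈K-trans (KS.solve 2 (λ N z → N KS.:+ (z KS.:* KS.con (+ 0)) KS.:* KS.con (+ 1) KS.:= N) ≈K-refl (ι (norm 0K)) ζ)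
              (≈K-trans (ι-cong norm-0K) (≈K-sym (norm≈0⇒≈0 (x , y) |z|²≈0)))))
    where
    |z|²≈0 : norm (x , y) ≈ 0#
    |z|²≈0 = begin
      x * x - α * (y * y)                 ≈⟨ solve 3 (λ x y g → x :* x :- g :* (y :* y) := (x :- con (+ 0)) :* (x :- con (+ 0)) :- g :* (y :* y)) refl x y α ⟩
      (x - 0#) * (x - 0#) - α * (y * y)   ≈⟨ +-congʳ (*-cong (+-congˡ (-‿cong (sym m≈0))) (+-congˡ (-‿cong (sym m≈0)))) ⟩
      (x - m) * (x - m) - α * (y * y)     ≈⟨ condition ⟩
      norm ζ * (m * (1# - m))             ≈⟨ *-congˡ (*-congʳ m≈0) ⟩
      norm ζ * (0# * (1# - m))            ≈⟨ solve 2 (λ n m → n :* (con (+ 0) :* (con (+ 1) :- m)) := con (+ 0)) refl (norm ζ) m ⟩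
      0#                                  ∎

  m≉0⇒InW : ¬ ζ ≈K 0K → ∀ x y m → W-condition (x , y) m → ¬ m ≈ 0# → InW (Aζ ζ) (x , y)
  m≉0⇒InW ζ≉0 x y m condition m≉0 = witness⇒InW v₁ v₂
    (trans (+-cong |v₁|²≈m |v₂|²≈1-m) (solve 1 (λ m → m :+ (con (+ 1) :- m) := con (+ 1)) refl m))
    (≈K-trans (+K-cong (ι-cong |v₁|²≈m) (≈K-trans (KR.*-comm w v₂) v₂w≈z-m))
              (KS.solve 2 (λ a z → a KS.:+ (z KS.:- a) KS.:= z) ≈K-refl (ι m) (x , y)))
    where
    v₁ : K
    v₁ = proj₁ (norm-surjective α-nonsquare m) , proj₁ (proj₂ (norm-surjective α-nonsquare m))
    |v₁|²≈m : norm v₁ ≈ m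
    |v₁|²≈m = proj₂ (proj₂ (norm-surjective α-nonsquare m))
    w : K
    w = ζ *K σ v₁
    w≉0 : ¬ w ≈K 0K
    w≉0 = x*Ky≉0 ζ≉0 (λ σv₁≈0 → m≉0 (trans (sym |v₁|²≈m) (trans (sym (norm-σ v₁)) (trans (norm-cong σv₁≈0) norm-0K))))
    v₂ : K
    v₂ = ((x , y) -K ι m) *K invK w
    v₂w≈z-m : v₂ *K w ≈K (x , y) -K ι m
    v₂w≈z-m = ≈K-trans (KR.*-assoc _ (invK w) w)
                (≈K-trans (*K-cong ≈K-refl (≈K-trans (KR.*-comm (invK w) w) (invK-inverseʳ w w≉0))) (KR.*-identityʳ _))
    |v₂|²≈1-m : norm v₂ ≈ 1# - m
    |v₂|²≈1-m = *-cancelˡ (x*y≉0 (λ |ζ|²≈0 → ζ≉0 (norm≈0⇒≈0 ζ |ζ|²≈0)) m≉0) (begin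
      (norm ζ * m) * norm v₂               ≈⟨ *-comm _ _ ⟩
      norm v₂ * (norm ζ * m)               ≈⟨ *-congˡ (*-congˡ (trans (norm-σ v₁) |v₁|²≈m)) ⟨
      norm v₂ * (norm ζ * norm (σ v₁))     ≈⟨ *-congˡ (norm-homo-* ζ (σ v₁)) ⟨
      norm v₂ * norm w                     ≈⟨ norm-homo-* v₂ w ⟨
      norm (v₂ *K w)                       ≈⟨ norm-cong v₂w≈z-m ⟩
      norm ((x , y) -K ι m)                ≈⟨ norm-−ι x y m ⟩
      (x - m) * (x - m) - α * (y * y)      ≈⟨ condition ⟩
      norm ζ * (m * (1# - m))              ≈⟨ *-assoc _ _ _ ⟨
      (norm ζ * m) * (1# - m)              ∎)

  W-condition⇒InW : ¬ ζ ≈K 0K → ∀ x y m → W-condition (x , y) m → InW (Aζ ζ) (x , y)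
  W-condition⇒InW ζ≉0 x y m condition =
    [ m≈0⇒InW x y m condition , m≉0⇒InW ζ≉0 x y m condition ]′ (toSum (m ≟ 0#))

module DualCurveVersusNumericalRange (F : FiniteField) (q-odd : FiniteField.card F % 2 ≡ 1)
            (α : FiniteField.Carrier F) (α-nonsquare : NonSquare F α) (ζ : Ext.K F α) where
  open import Data.Product using (_×_; _,_; proj₁; proj₂)
  open import Data.Sum using (inj₁; inj₂; [_,_]′)
  open import Function using (_∘_)
  open import Relation.Nullary.Decidable using (toSum)
  open import Data.Empty using (⊥; ⊥-elim)
  open import Data.Integer using (+_)

  open FiniteField F
  open FiniteFieldFacts F
  open Ext F α
  open QuadraticExtension F α α-nonsquare
  open Squares F q-odd
  open DualCurve F q-odd α α-nonsquare ζ
  open NumericalRange F q-odd α α-nonsquare ζ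
  open IntegerRingSolver cring using (solve; _:=_; _:+_; _:*_; :-_; _:-_; con)
  open import Relation.Binary.Reasoning.Setoid setoid

  |ζ|²≈ι-n : normSq ζ ≈K ι n
  |ζ|²≈ι-n = ≈K-trans (*K-cong ≈K-refl (Frobenius.conj≈σ F α α-nonsquare q-odd ζ)) (x*σx≈ι-norm ζ)

  n≉0⇒ζ≉0 : ¬ n ≈ 0# → ¬ ζ ≈K 0K
  n≉0⇒ζ≉0 n≉0 ζ≈0 = n≉0 (trans (norm-cong ζ≈0) norm-0K)

  -- The discriminant of the quadratic in m defining the W-condition.
  disc≈square-W-condition : ∀ x y m → disc x y ≈
    (2# * (n + 1#) * m - (2# * x + n)) * (2# * (n + 1#) * m - (2# * x + n))
    - 2# * 2# * (n + 1#) * (((x - m) * (x - m) - α * (y * y)) - n * (m * (1# - m)))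
  disc≈square-W-condition x y m = solve 5 (λ n a x y m →
    (con (+ 2) :* x :+ n) :* (con (+ 2) :* x :+ n) :- con (+ 2) :* con (+ 2) :* (n :+ con (+ 1)) :* (x :* x :- a :* (y :* y))
    := (con (+ 2) :* (n :+ con (+ 1)) :* m :- (con (+ 2) :* x :+ n)) :* (con (+ 2) :* (n :+ con (+ 1)) :* m :- (con (+ 2) :* x :+ n))
       :- con (+ 2) :* con (+ 2) :* (n :+ con (+ 1)) :* (((x :- m) :* (x :- m) :- a :* (y :* y)) :- n :* (m :* (con (+ 1) :- m))))
    refl n α x y m

  W-condition⇒disc-square : ∀ x y m → W-condition (x , y) m → IsSquare (disc x y)
  W-condition⇒disc-square x y m condition = S , sym (begin
    disc x y                                                ≈⟨ disc≈square-W-condition x y m ⟩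
    S * S - 2# * 2# * (n + 1#) * (((x - m) * (x - m) - α * (y * y)) - n * (m * (1# - m)))
      ≈⟨ +-congˡ (-‿cong (*-congˡ (trans (+-congʳ condition) (-‿inverseʳ _)))) ⟩
    S * S - 2# * 2# * (n + 1#) * 0#                          ≈⟨ solve 2 (λ s c → s :* s :- c :* con (+ 0) := s :* s) refl S (2# * 2# * (n + 1#)) ⟩
    S * S                                                   ∎)
    where
    S : Carrier
    S = 2# * (n + 1#) * m - (2# * x + n)

  disc≈0⇒W-condition : ¬ n + 1# ≈ 0# → ∀ x y → disc x y ≈ 0# → W-condition (x , y) ((2# * x + n) * (2# * (n + 1#)) ⁻¹)
  disc≈0⇒W-condition n+1≉0 x y disc≈0 = begin
    (x - m) * (x - m) - α * (y * y)                ≈⟨ solve 2 (λ p r → p := (p :- r) :+ r) refl _ (n * (m * (1# - m))) ⟩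
    (P - n * (m * (1# - m))) + n * (m * (1# - m))  ≈⟨ +-congʳ P-R≈0 ⟩
    0# + n * (m * (1# - m))                        ≈⟨ +-identityˡ _ ⟩
    n * (m * (1# - m))                             ∎
    where
    T m P S C : Carrier
    T = 2# * (n + 1#)
    m = (2# * x + n) * T ⁻¹
    P = (x - m) * (x - m) - α * (y * y)
    S = T * m - (2# * x + n)
    C = 2# * 2# * (n + 1#)
    T≉0 : ¬ T ≈ 0#
    T≉0 = x*y≉0 (2≉0 q-odd) n+1≉0
    S≈0 : S ≈ 0#
    S≈0 = trans (+-congʳ (trans (solve 3 (λ t w i → t :* (w :* i) := w :* (t :* i)) refl T (2# * x + n) (T ⁻¹))
                                 (trans (*-congˡ (⁻¹-inverse T T≉0)) (*-identityʳ _))))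
                (-‿inverseʳ _)
    P-R≈0 : P - n * (m * (1# - m)) ≈ 0#
    P-R≈0 = *-cancelˡ (x*y≉0 (x*y≉0 (2≉0 q-odd) (2≉0 q-odd)) n+1≉0) (begin
      C * (P - n * (m * (1# - m)))                    ≈⟨ solve 2 (λ w s → w := s :* s :- (s :* s :- w)) refl _ S ⟩
      S * S - (S * S - C * (P - n * (m * (1# - m))))  ≈⟨ +-congˡ (-‿cong (disc≈square-W-condition x y m)) ⟨
      S * S - disc x y                                ≈⟨ +-cong (*-cong S≈0 S≈0) (-‿cong disc≈0) ⟩
      0# * 0# - 0#                                    ≈⟨ solve 1 (λ c → con (+ 0) :* con (+ 0) :- con (+ 0) := c :* con (+ 0)) refl C ⟩
      C * 0#                                          ∎)

  W-condition-as-norm : ∀ x y m → (x - m) * (x - m) - α * (y * y) ≈ (norm (x , y) - (2# * x - 1#) * m) + - 1# * (m * (1# - m))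
  W-condition-as-norm x y m = solve 4 (λ x y m a →
    (x :- m) :* (x :- m) :- a :* (y :* y)
    := (x :* x :- a :* (y :* y) :- (con (+ 2) :* x :- con (+ 1)) :* m) :+ :- con (+ 1) :* (m :* (con (+ 1) :- m))) refl x y m α

  module n≈-1 (n≈-1 : n ≈ - 1#) where

    disc≈[2x-1]² : ∀ x y → disc x y ≈ (2# * x - 1#) * (2# * x - 1#)
    disc≈[2x-1]² x y = trans (+-cong (*-cong (+-congˡ n≈-1) (+-congˡ n≈-1)) (-‿cong (*-congʳ (*-congˡ (+-congʳ n≈-1)))))
      (solve 3 (λ x y a → (con (+ 2) :* x :+ :- con (+ 1)) :* (con (+ 2) :* x :+ :- con (+ 1))
                        :- con (+ 2) :* con (+ 2) :* (:- con (+ 1) :+ con (+ 1)) :* (x :* x :- a :* (y :* y))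
                        := (con (+ 2) :* x :- con (+ 1)) :* (con (+ 2) :* x :- con (+ 1))) refl x y α)

    norm⇒W-condition : ∀ x y m → norm (x , y) ≈ (2# * x - 1#) * m → W-condition (x , y) m
    norm⇒W-condition x y m |z|²≈[2x-1]m = begin
      (x - m) * (x - m) - α * (y * y)                               ≈⟨ W-condition-as-norm x y m ⟩
      (norm (x , y) - (2# * x - 1#) * m) + - 1# * (m * (1# - m))    ≈⟨ +-cong (trans (+-congʳ |z|²≈[2x-1]m) (-‿inverseʳ _)) (*-congʳ (sym n≈-1)) ⟩
      0# + n * (m * (1# - m))                                       ≈⟨ +-identityˡ _ ⟩
      n * (m * (1# - m))                                            ∎

    W-condition⇒norm : ∀ x y m → W-condition (x , y) m → norm (x , y) ≈ (2# * x - 1#) * m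
    W-condition⇒norm x y m condition = begin
      norm (x , y)                                                  ≈⟨ solve 3 (λ N t r → N := ((N :- t) :+ r) :- r :+ t) refl (norm (x , y)) t r ⟩
      ((norm (x , y) - t) + r) - r + t                              ≈⟨ +-congʳ (+-congʳ (W-condition-as-norm x y m)) ⟨
      ((x - m) * (x - m) - α * (y * y)) - r + t                     ≈⟨ +-congʳ (+-cong condition (-‿cong (*-congʳ (sym n≈-1)))) ⟩
      n * (m * (1# - m)) - n * (m * (1# - m)) + t                   ≈⟨ +-congʳ (-‿inverseʳ _) ⟩
      0# + t                                                        ≈⟨ +-identityˡ t ⟩
      t                                                             ∎
      where
      t r : Carrier
      t = (2# * x - 1#) * m
      r = - 1# * (m * (1# - m))

    on-line⇒InDual : ∀ {x y} → 2# * x - 1# ≈ 0# → InDual (Aζ ζ) (x , y)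
    on-line⇒InDual {x} {y} 2x-1≈0 = disc≈0⇒InDual x y (trans (disc≈[2x-1]² x y) (trans (*-congʳ 2x-1≈0) (zeroˡ _)))

    off-line⇒InW : ∀ {x y} → ¬ 2# * x - 1# ≈ 0# → InW (Aζ ζ) (x , y)
    off-line⇒InW {x} {y} 2x-1≉0 = W-condition⇒InW (n≉0⇒ζ≉0 (λ n≈0 → -1≉0 (trans (sym n≈-1) n≈0))) x y m (norm⇒W-condition x y m (sym (begin
      t * (norm (x , y) * t ⁻¹)       ≈⟨ solve 3 (λ t N i → t :* (N :* i) := N :* (t :* i)) refl t (norm (x , y)) (t ⁻¹) ⟩
      norm (x , y) * (t * t ⁻¹)       ≈⟨ *-congˡ (⁻¹-inverse t 2x-1≉0) ⟩
      norm (x , y) * 1#               ≈⟨ *-identityʳ _ ⟩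
      norm (x , y)                    ∎)))
      where
      t m : Carrier
      t = 2# * x - 1#
      m = norm (x , y) * t ⁻¹

    union : UnionIsAll (Aζ ζ)
    union (x , y) = [ inj₁ ∘ on-line⇒InDual , inj₂ ∘ off-line⇒InW ]′ (toSum (2# * x - 1# ≟ 0#))

    disjoint : Disjoint (Aζ ζ)
    disjoint (x , y) in-dual in-W = -1≉0 (begin
      - 1#               ≈⟨ solve 0 (:- con (+ 1) := con (+ 2) :* con (+ 0) :- con (+ 1)) refl ⟩
      2# * 0# - 1#       ≈⟨ +-congʳ (*-congˡ (proj₁ (norm≈0⇒≈0 (x , y) |z|²≈0))) ⟨
      2# * x - 1#        ≈⟨ 2x-1≈0 ⟩
      0#                 ∎)
      where
      2x-1≈0 : 2# * x - 1# ≈ 0#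
      2x-1≈0 = x*x≈0⇒x≈0 (trans (sym (disc≈[2x-1]² x y)) (InDual⇒disc≈0 in-dual))
      |z|²≈0 : norm (x , y) ≈ 0#
      |z|²≈0 = trans (W-condition⇒norm x y (proj₁ (InW⇒W-condition in-W)) (proj₂ (InW⇒W-condition in-W))) (trans (*-congʳ 2x-1≈0) (zeroˡ _))

  disc≈ : ∀ x y → disc x y ≈ (2# * x + n) * (2# * x + n) - (n + 1#) * ((2# * x) * (2# * x) - α * ((2# * y) * (2# * y)))
  disc≈ x y = solve 4 (λ n a x y →
    (con (+ 2) :* x :+ n) :* (con (+ 2) :* x :+ n) :- con (+ 2) :* con (+ 2) :* (n :+ con (+ 1)) :* (x :* x :- a :* (y :* y))
    := (con (+ 2) :* x :+ n) :* (con (+ 2) :* x :+ n)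
       :- (n :+ con (+ 1)) :* ((con (+ 2) :* x) :* (con (+ 2) :* x) :- a :* ((con (+ 2) :* y) :* (con (+ 2) :* y)))) refl n α x y

  module n≉-1 (n≉-1 : ¬ n ≈ - 1#) (union : UnionIsAll (Aζ ζ)) (disjoint : Disjoint (Aζ ζ)) where

    n+1≉0 : ¬ n + 1# ≈ 0#
    n+1≉0 n+1≈0 = n≉-1 (trans (solve 1 (λ n → n := (n :+ con (+ 1)) :- con (+ 1)) refl n) (trans (+-congʳ n+1≈0) (+-identityˡ _)))

    -- For |ζ|² = 0, the point 1 lies on both.
    n≉0 : ¬ n ≈ 0#
    n≉0 n≈0 = disjoint 1K (disc≈0⇒InDual 1# 0# disc[1,0]≈0) (witness⇒InW 1K 0K
      (solve 1 (λ a → (con (+ 1) :* con (+ 1) :- a :* (con (+ 0) :* con (+ 0))) :+ (con (+ 0) :* con (+ 0) :- a :* (con (+ 0) :* con (+ 0)))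
                 := con (+ 1)) refl α)
      (≈K-trans (+K-cong ≈K-refl (KR.zeroʳ _)) (≈K-trans (KR.+-identityʳ _)
        (ι-cong (solve 1 (λ a → con (+ 1) :* con (+ 1) :- a :* (con (+ 0) :* con (+ 0)) := con (+ 1)) refl α)))))
      where
      disc[1,0]≈0 : disc 1# 0# ≈ 0#
      disc[1,0]≈0 = trans (+-cong (*-cong (+-congˡ n≈0) (+-congˡ n≈0)) (-‿cong (*-congʳ (*-congˡ (+-congʳ n≈0)))))
        (solve 1 (λ a → (con (+ 2) :* con (+ 1) :+ con (+ 0)) :* (con (+ 2) :* con (+ 1) :+ con (+ 0))
                      :- con (+ 2) :* con (+ 2) :* (con (+ 0) :+ con (+ 1)) :* (con (+ 1) :* con (+ 1) :- a :* (con (+ 0) :* con (+ 0)))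
                      := con (+ 0)) refl α)

    no-disc-zero : ∀ x y → ¬ disc x y ≈ 0#
    no-disc-zero x y disc≈0 = disjoint (x , y) (disc≈0⇒InDual x y disc≈0)
      (W-condition⇒InW (n≉0⇒ζ≉0 n≉0) x y ((2# * x + n) * (2# * (n + 1#)) ⁻¹) (disc≈0⇒W-condition n+1≉0 x y disc≈0))

    no-disc-nonsquare : ∀ x y → ¬ NonSquare F (disc x y)
    no-disc-nonsquare x y nonsquare = [ not-in-dual , not-in-W ]′ (union (x , y))
      where
      not-in-dual : ¬ InDual (Aζ ζ) (x , y)
      not-in-dual in-dual = nonsquare 0# (trans (zeroʳ 0#) (sym (InDual⇒disc≈0 in-dual)))
      not-in-W : ¬ InW (Aζ ζ) (x , y)
      not-in-W in-W = nonsquare (proj₁ square) (proj₂ square)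
        where
        square : IsSquare (disc x y)
        square = W-condition⇒disc-square x y (proj₁ (InW⇒W-condition in-W)) (proj₂ (InW⇒W-condition in-W))

    h : Carrier
    h = 2# ⁻¹

    2h≈1 : 2# * h ≈ 1#
    2h≈1 = ⁻¹-inverse 2# (2≉0 q-odd)

    n+1-nonsquare : NonSquare F (n + 1#)
    n+1-nonsquare t t*t≈n+1 = no-disc-zero x 0# (begin
      disc x 0#             ≈⟨ disc≈ x 0# ⟩
      (2# * x + n) * (2# * x + n) - (n + 1#) * ((2# * x) * (2# * x) - α * ((2# * 0#) * (2# * 0#)))
        ≈⟨ +-cong (*-cong (+-cong 2x≈1+t n≈t*t-1) (+-cong 2x≈1+t n≈t*t-1)) (-‿cong (*-cong (sym t*t≈n+1) (+-congʳ (*-cong 2x≈1+t 2x≈1+t)))) ⟩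
      ((1# + t) + (t * t - 1#)) * ((1# + t) + (t * t - 1#)) - (t * t) * ((1# + t) * (1# + t) - α * ((2# * 0#) * (2# * 0#)))
        ≈⟨ solve 2 (λ t a → ((con (+ 1) :+ t) :+ (t :* t :- con (+ 1))) :* ((con (+ 1) :+ t) :+ (t :* t :- con (+ 1)))
                          :- (t :* t) :* ((con (+ 1) :+ t) :* (con (+ 1) :+ t) :- a :* ((con (+ 2) :* con (+ 0)) :* (con (+ 2) :* con (+ 0))))
                          := con (+ 0)) refl t α ⟩
      0#                    ∎)
      where
      x : Carrier
      x = (1# + t) * h
      2x≈1+t : 2# * x ≈ 1# + t
      2x≈1+t = trans (solve 3 (λ w t h → w :* ((con (+ 1) :+ t) :* h) := (con (+ 1) :+ t) :* (w :* h)) refl 2# t h)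
                     (trans (*-congˡ 2h≈1) (*-identityʳ _))
      n≈t*t-1 : n ≈ t * t - 1#
      n≈t*t-1 = trans (solve 1 (λ n → n := (n :+ con (+ 1)) :- con (+ 1)) refl n) (+-congʳ (sym t*t≈n+1))

    -- With n = a² − αb², the point 1/2 + β b/2 has discriminant a²(n + 1).
    a b : Carrier
    a = proj₁ (norm-surjective α-nonsquare n)
    b = proj₁ (proj₂ (norm-surjective α-nonsquare n))

    a*a-αb*b≈n : a * a - α * (b * b) ≈ n
    a*a-αb*b≈n = proj₂ (proj₂ (norm-surjective α-nonsquare n))

    2bh≈b : 2# * (b * h) ≈ b
    2bh≈b = trans (solve 3 (λ w b h → w :* (b :* h) := b :* (w :* h)) refl 2# b h) (trans (*-congˡ 2h≈1) (*-identityʳ b))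
    disc≈a*a*[n+1] : disc h (b * h) ≈ a * a * (n + 1#)
    disc≈a*a*[n+1] = begin
      disc h (b * h)     ≈⟨ disc≈ h (b * h) ⟩
      (2# * h + n) * (2# * h + n) - (n + 1#) * ((2# * h) * (2# * h) - α * ((2# * (b * h)) * (2# * (b * h))))
        ≈⟨ +-cong (*-cong (+-congʳ 2h≈1) (+-congʳ 2h≈1)) (-‿cong (*-congˡ (+-cong (*-cong 2h≈1 2h≈1) (-‿cong (*-congˡ (*-cong 2bh≈b 2bh≈b)))))) ⟩
      (1# + n) * (1# + n) - (n + 1#) * (1# * 1# - α * (b * b))
        ≈⟨ solve 3 (λ n a b → (con (+ 1) :+ n) :* (con (+ 1) :+ n) :- (n :+ con (+ 1)) :* (con (+ 1) :* con (+ 1) :- a :* (b :* b))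
                            := (n :+ a :* (b :* b)) :* (n :+ con (+ 1))) refl n α b ⟩
      (n + α * (b * b)) * (n + 1#)
        ≈⟨ *-congʳ (trans (+-congʳ (sym a*a-αb*b≈n)) (solve 3 (λ a b g → (a :* a :- g :* (b :* b)) :+ g :* (b :* b) := a :* a) refl a b α)) ⟩
      a * a * (n + 1#)   ∎

    a≈0⇒disc-zero : a ≈ 0# → ⊥
    a≈0⇒disc-zero a≈0 = no-disc-zero h (b * h) (trans disc≈a*a*[n+1] (trans (*-congʳ (*-cong a≈0 a≈0)) (trans (*-congʳ (zeroˡ 0#)) (zeroˡ _))))

    a≉0⇒disc-nonsquare : ¬ a ≈ 0# → ⊥
    a≉0⇒disc-nonsquare a≉0 = no-disc-nonsquare h (b * h) (NonSquare-resp (sym disc≈a*a*[n+1])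
                      (square*nonsquare-nonsquare (x*y≉0 a≉0 a≉0) (a , refl) n+1-nonsquare))

    contradiction : ⊥
    contradiction = [ a≈0⇒disc-zero , a≉0⇒disc-nonsquare ]′ (toSum (a ≟ 0#))

  |ζ|²≈-1⇒union×disjoint : normSq ζ ≈K ι (- 1#) → UnionIsAll (Aζ ζ) × Disjoint (Aζ ζ)
  |ζ|²≈-1⇒union×disjoint |ζ|²≈-1 = n≈-1.union n≈-1 , n≈-1.disjoint n≈-1
    where
    n≈-1 : n ≈ - 1#
    n≈-1 = ι-injective (≈K-trans (≈K-sym |ζ|²≈ι-n) |ζ|²≈-1)

  union×disjoint⇒|ζ|²≈-1 : UnionIsAll (Aζ ζ) × Disjoint (Aζ ζ) → normSq ζ ≈K ι (- 1#)
  union×disjoint⇒|ζ|²≈-1 (union , disjoint) =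
    [ ≈K-trans |ζ|²≈ι-n ∘ ι-cong , (λ n≉-1 → ⊥-elim (n≉-1.contradiction n≉-1 union disjoint)) ]′ (toSum (n ≟ - 1#))

proposition8p2 : (F : FiniteField) → FiniteField.card F % 2 ≡ 1 →
    (α : FiniteField.Carrier F) → NonSquare F α → (ζ : Ext.K F α) →
    ((Ext._≈K_ F α (Ext.normSq F α ζ) (Ext.ι F α (FiniteField.-_ F (FiniteField.1# F)))) →
       (Ext.UnionIsAll F α (Ext.Aζ F α ζ) × Ext.Disjoint F α (Ext.Aζ F α ζ)))
    × ((Ext.UnionIsAll F α (Ext.Aζ F α ζ) × Ext.Disjoint F α (Ext.Aζ F α ζ)) →
       Ext._≈K_ F α (Ext.normSq F α ζ) (Ext.ι F α (FiniteField.-_ F (FiniteField.1# F))))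
proposition8p2 F q-odd α α-nonsquare ζ = |ζ|²≈-1⇒union×disjoint , union×disjoint⇒|ζ|²≈-1
  where open DualCurveVersusNumericalRange F q-odd α α-nonsquare ζ
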